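{- Let $G$ be a bi-block graph with blocks $K_{m_i,n_i}$, $i=1,\dots,r$, on $\mathbf{n}=\sum_{i=1}^r(m_i+n_i)-(r-1)$ vertices, where the $i$-th block has bipartition $X_i\cup Y_i$ with $|X_i|=m_i$, $|Y_i|=n_i$. Let $q$ be a nonzero indeterminate and $\mathscr{F}$ the exponential distance matrix of $G$. If $\mathscr{F}$ is invertible, then $$\mathscr{F}^{ -1}=\frac{1}{1-q^2}I_{\mathbf{n}}-\frac{q}{1-q^2}\mathbf{A}+\frac{q^2}{1-q^2}\mathbf{B}+\frac{q^2}{1-q^2}\,\mathrm{diag}(\mu),$$ where $\mathbf{A}=[a_{uv}]$, $\mathbf{B}=[b_{uv}]$ are the $\mathbf{n}\times\mathbf{n}$ matrices and $\mu$ the vector indexed by $V(G)$ defined by $$a_{uv}=\begin{cases}\dfrac{1}{1-q^2(m_i-1)(n_i-1)} & \text{if } u\sim v \text{ and } u,v\in K_{m_i,n_i},\\ 0&\text{otherwise,}\end{cases}$$ $$b_{uv}=\begin{cases}\dfrac{n_i-1}{1-q^2(m_i-1)(n_i-1)} & \text{if } u\neq v,\ u\not\sim v,\ u,v\in X_i,\\ \dfrac{m_i-1}{1-q^2(m_i-1)(n_i-1)} & \text{if } u\neq v,\ u\not\sim v,\ u,v\in Y_i,\\ 0&\text{otherwise,}\end{cases}$$ $$\mu(v)=\sum_{i:\,v\in X_i}\frac{n_i-1}{1-q^2(m_i-1)(n_i-1)}+\sum_{i:\,v\in Y_i}\frac{m_i-1}{1-q^2(m_i-1)(n_i-1)}+(k-1),$$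 with $k$ the number of blocks of $G$ containing $v$.
   Context: All graphs are finite, simple and connected; $u\sim v$ means $u,v$ are adjacent. A bi-block graph is a connected graph each of whose blocks (maximal connected subgraphs without a cut vertex) is a complete bipartite graph. For a connected graph with vertices $v_1,\dots,v_{\mathbf{n}}$ and shortest-path distance $d_{ij}$, the exponential distance matrix is $\mathscr{F}=(q^{d_{ij}})$, $q$ a nonzero indeterminate. $I_{\mathbf{n}}$ is the identity matrix and $\mathrm{diag}(\mu)$ the diagonal matrix with diagonal $\mu$. -}

module Defs where

open import Level using (Level; _⊔_)
open import Data.Nat as ℕ using (ℕ; zero; suc; _∸_; _≤_)
open import Data.Fin using (Fin; zero; suc; _≟_)
open import Data.Bool using (Bool; true; false; if_then_else_; _∧_; not)
open import Data.Product using (Σ; ∃; _×_; _,_)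
open import Data.Sum using (_⊎_)
open import Data.Empty using (⊥)
open import Relation.Nullary using (¬_; does)
open import Relation.Binary.PropositionalEquality using (_≡_)
open import Function.Bundles using (_⇔_)
open import Algebra.Bundles using (CommutativeRing)

record Field (c ℓ : Level) : Set (Level.suc (c ⊔ ℓ)) where
  field
    commutativeRing : CommutativeRing c ℓ
  open CommutativeRing commutativeRing public
  field
    0≉1     : ¬ (0# ≈ 1#)
    inverse : ∀ x → ¬ (x ≈ 0#) → ∃ λ y → y * x ≈ 1#

record Graph (N : ℕ) : Set where
  field
    adj    : Fin N → Fin N → Bool
    sym    : ∀ u v → adj u v ≡ adj v u
    irrefl : ∀ v → adj v v ≡ false

VSet : ℕ → Set
VSet N = Fin N → Bool

_∈_ : ∀ {N} → Fin N → VSet N → Set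
v ∈ S = S v ≡ true

_⊆_ : ∀ {N} → VSet N → VSet N → Set
S ⊆ T = ∀ v → v ∈ S → v ∈ T

full : ∀ {N} → VSet N
full _ = true

_∪_ : ∀ {N} → VSet N → VSet N → VSet N
(S ∪ T) v = if S v then true else T v

_─_ : ∀ {N} → VSet N → Fin N → VSet N
(S ─ w) v = S v ∧ not (does (v ≟ w))

module _ {N : ℕ} (G : Graph N) where
  open Graph G

  data Walk (P : VSet N) : Fin N → Fin N → ℕ → Set where
    here : ∀ {v} → v ∈ P → Walk P v v 0
    step : ∀ {u w v k} → u ∈ P → adj u w ≡ true → Walk P w v k →
           Walk P u v (suc k)

  ConnectedOn : VSet N → Set
  ConnectedOn P = ∀ u v → u ∈ P → v ∈ P → ∃ λ k → Walk P u v k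

  Connected : Set
  Connected = ConnectedOn full

  Biconn : VSet N → Set
  Biconn S = (∃ λ v → v ∈ S) × ConnectedOn S
           × (∀ w → w ∈ S → ConnectedOn (S ─ w))

  -- S is the vertex set of a block: a maximal connected subgraph without a
  -- cut vertex (blocks are induced subgraphs, so they are determined by
  -- their vertex sets)
  IsBlock : VSet N → Set
  IsBlock S = Biconn S × (∀ T → S ⊆ T → Biconn T → T ⊆ S)

  Dist : Fin N → Fin N → ℕ → Set
  Dist u v d = Walk full u v d × (∀ k → Walk full u v k → d ≤ k)

  record BiBlock (r : ℕ) : Set where
    field
      X Y        : Fin r → VSet N
      connected  : Connected
      X-nonempty : ∀ i → ∃ λ v → v ∈ X i
      Y-nonempty : ∀ i → ∃ λ v → v ∈ Y i
      disjoint   : ∀ i v → v ∈ X i → v ∈ Y i → ⊥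
      bipartite  : ∀ i u v → u ∈ (X i ∪ Y i) → v ∈ (X i ∪ Y i) →
                   (adj u v ≡ true) ⇔ ((u ∈ X i × v ∈ Y i) ⊎ (u ∈ Y i × v ∈ X i))
      isBlock    : ∀ i → IsBlock (X i ∪ Y i)
      distinct   : ∀ i j → (∀ v → (X i ∪ Y i) v ≡ (X j ∪ Y j) v) → i ≡ j
      complete   : ∀ S → IsBlock S → ∃ λ i → ∀ v → S v ≡ (X i ∪ Y i) v

countℕ : ∀ {n} → (Fin n → Bool) → ℕ
countℕ {zero}  f = 0
countℕ {suc n} f = (if f zero then 1 else 0) ℕ.+ countℕ (λ i → f (suc i))

module Matrices {c ℓ : Level} (R : CommutativeRing c ℓ) where
  open CommutativeRing R using (Carrier; _≈_; _+_; _*_; _-_; 0#; 1#)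

  Σ[_] : ∀ {n} → (Fin n → Carrier) → Carrier
  Σ[_] {zero}  f = 0#
  Σ[_] {suc n} f = f zero + Σ[ (λ i → f (suc i)) ]

  ℕ→R : ℕ → Carrier
  ℕ→R zero    = 0#
  ℕ→R (suc n) = 1# + ℕ→R n

  pow : Carrier → ℕ → Carrier
  pow x zero    = 1#
  pow x (suc n) = x * pow x n

  [_] : Bool → Carrier → Carrier
  [ b ] x = if b then x else 0#

  Matrix : ℕ → Set c
  Matrix N = Fin N → Fin N → Carrier

  _·_ : ∀ {N} → Matrix N → Matrix N → Matrix N
  (M · M′) u v = Σ[ (λ w → M u w * M′ w v) ]

  δ : ∀ {N} → Fin N → Fin N → Bool
  δ u v = does (u ≟ v)

  I : ∀ {N} → Matrix N
  I u v = [ δ u v ] 1#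

  _≈M_ : ∀ {N} → Matrix N → Matrix N → Set ℓ
  M ≈M M′ = ∀ u v → M u v ≈ M′ u v

  IsExpDist : ∀ {N} → Graph N → Carrier → Matrix N → Set ℓ
  IsExpDist G q F = ∀ u v d → Dist G u v d → F u v ≈ pow q d

  module Formula {N r : ℕ} (G : Graph N) (D : BiBlock G r)
                 (q : Carrier)
                 -- d  plays the role of 1 / (1 - q²)
                 (d : Carrier)
                 -- c i plays the role of 1 / (1 - q²(m_i - 1)(n_i - 1))
                 (c : Fin r → Carrier) where
    open Graph G
    open BiBlock D

    B : Fin r → VSet N
    B i = X i ∪ Y i

    m n : Fin r → ℕ
    m i = countℕ (X i)
    n i = countℕ (Y i)

    -- a_uv = 1/(1-q²(m_i-1)(n_i-1)) if u ~ v and u, v ∈ K_{m_i,n_i}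
    -- (for adjacent u, v the block containing both is unique)
    𝐀 : Matrix N
    𝐀 u v = Σ[ (λ i → [ adj u v ∧ B i u ∧ B i v ] (c i)) ]

    𝐁 : Matrix N
    𝐁 u v = Σ[ (λ i →
              [ not (δ u v) ∧ not (adj u v) ∧ X i u ∧ X i v ] (c i * ℕ→R (n i ∸ 1))
            + [ not (δ u v) ∧ not (adj u v) ∧ Y i u ∧ Y i v ] (c i * ℕ→R (m i ∸ 1))) ]

    k : Fin N → ℕ
    k v = countℕ (λ i → B i v)

    μ : Fin N → Carrier
    μ v = Σ[ (λ i → [ X i v ] (c i * ℕ→R (n i ∸ 1))
                  + [ Y i v ] (c i * ℕ→R (m i ∸ 1))) ]
          + (ℕ→R (k v) - 1#)

    RHS : Matrix N
    RHS u v = d * I u v - d * q * 𝐀 u v + d * (q * q) * 𝐁 u v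
              + d * (q * q) * [ δ u v ] (μ v)

-- For a block K and a vertex v, every vertex w of K reaches v through the gate g, the vertex
-- of K nearest to v: d(w,v) = d(w,g) + d(g,v). Otherwise a walk leaving K for good at another
-- vertex would, together with a geodesic from g, bypass K, and a shortest bypass is an ear that
-- would enlarge the block. Entry (u,v) of RHS·F therefore splits into one term per block
-- K_{m,n} ∋ u, and summing q^d(w,v) over the two sides of the block shows that this term is 0
-- if u is the gate and d(q²-1)q^d(u,v) otherwise; this is where 1/(1-q²(m-1)(n-1)) cancels.
-- For u ≠ v exactly one block through u does not have u as its gate (the block of the first
-- edge of a geodesic; two such blocks would again give a bypass), and for u = v there is none.
-- Hence RHS·F = I, and the inverse M equals RHS.

module Submission where

open import Level using (Level)
open import Algebra.Bundles using (CommutativeRing)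
open import Data.Bool using (Bool; true; false; _∧_; _∨_; not)
open import Data.Bool.Properties using (∧-conicalˡ; ∧-conicalʳ; ∧-zeroʳ; ∧-identityʳ; not-injective)
open import Data.Empty using (⊥; ⊥-elim)
open import Data.Fin using (Fin; zero; suc; _≟_)
import Data.Fin.Properties as Finₚ
import Data.Nat as Nat
open Nat using (ℕ; zero; suc; _≤_; _<_; z≤n; s≤s; _∸_)
import Data.Nat.Properties as ℕₚ
open import Data.Unit using (⊤; tt)
open import Data.Product using (Σ; ∃; _×_; _,_; proj₁; proj₂)
open import Data.Sum using (_⊎_; inj₁; inj₂; swap)
open import Function.Base using (_∘_)
open import Function.Bundles using (Equivalence; mk⇔)
open import Relation.Nullary using (¬_; Dec; yes; no; does)
open import Relation.Nullary.Decidable using (dec-true; dec-false; does-⇔)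
open import Relation.Binary.PropositionalEquality as ≡ using (_≡_)
open import Defs

module VertexSets where
  open ≡ using (refl; sym; trans; cong)

  true-or-false : ∀ b → b ≡ true ⊎ b ≡ false
  true-or-false true  = inj₁ refl
  true-or-false false = inj₂ refl

  true≢false : ∀ {b} → b ≡ true → b ≡ false → ⊥
  true≢false refl ()

  ∧-intro : ∀ {a b} → a ≡ true → b ≡ true → a ∧ b ≡ true
  ∧-intro refl refl = refl

  ∧-elimˡ : ∀ {a b} → a ∧ b ≡ true → a ≡ true
  ∧-elimˡ = ∧-conicalˡ _ _

  ∧-elimʳ : ∀ {a b} → a ∧ b ≡ true → b ≡ true
  ∧-elimʳ = ∧-conicalʳ _ _

  ∨-elim : ∀ {a b} → a ∨ b ≡ true → a ≡ true ⊎ b ≡ true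
  ∨-elim {true}  e = inj₁ refl
  ∨-elim {false} e = inj₂ e

  ∨-introˡ : ∀ {a} b → a ≡ true → a ∨ b ≡ true
  ∨-introˡ b refl = refl

  ∨-introʳ : ∀ a {b} → b ≡ true → a ∨ b ≡ true
  ∨-introʳ true  e = refl
  ∨-introʳ false e = e

  ≟-true : ∀ {N} (x y : Fin N) → does (x ≟ y) ≡ true → x ≡ y
  ≟-true x y e with x ≟ y
  ... | yes p = p

  ≟-false : ∀ {N} (x y : Fin N) → does (x ≟ y) ≡ false → ¬ x ≡ y
  ≟-false x y e with x ≟ y
  ... | no p = p

  ≟-refl : ∀ {N} (x : Fin N) → does (x ≟ x) ≡ true
  ≟-refl x = dec-true (x ≟ x) refl

  module _ {N : ℕ} {S T : VSet N} {v : Fin N} where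

    ∈-∪⁻ : v ∈ (S ∪ T) → v ∈ S ⊎ v ∈ T
    ∈-∪⁻ e with S v
    ... | true  = inj₁ refl
    ... | false = inj₂ e

    ∈-∪⁺ˡ : v ∈ S → v ∈ (S ∪ T)
    ∈-∪⁺ˡ e with S v
    ... | true = refl

    ∈-∪⁺ʳ : v ∈ T → v ∈ (S ∪ T)
    ∈-∪⁺ʳ e with S v
    ... | true  = refl
    ... | false = e

  module _ {N : ℕ} {S : VSet N} {v z : Fin N} where

    ∈-─⁺ : v ∈ S → ¬ v ≡ z → v ∈ (S ─ z)
    ∈-─⁺ vS v≢z = ∧-intro vS (cong not (dec-false (v ≟ z) v≢z))

    ∈-─⁻ˡ : v ∈ (S ─ z) → v ∈ S
    ∈-─⁻ˡ = ∧-elimˡ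

    ∈-─⁻ʳ : v ∈ (S ─ z) → ¬ v ≡ z
    ∈-─⁻ʳ e = ≟-false v z (not-injective (∧-elimʳ {S v} e))

  ─-mono : ∀ {N} {S T : VSet N} {z} → S ⊆ T → (S ─ z) ⊆ (T ─ z)
  ─-mono S⊆T x x∈ = ∧-intro (S⊆T x (∧-elimˡ x∈)) (∧-elimʳ x∈)

  ∉⇒≢ : ∀ {N} {S : VSet N} {x y} → x ∈ S → S y ≡ false → ¬ x ≡ y
  ∉⇒≢ xS yS refl = true≢false xS yS

  ⊆⇒∉ : ∀ {N} {S T : VSet N} {v} → S ⊆ T → T v ≡ false → S v ≡ false
  ⊆⇒∉ {S = S} {v = v} S⊆T v∉T with true-or-false (S v)
  ... | inj₁ vS = ⊥-elim (true≢false (S⊆T v vS) v∉T)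
  ... | inj₂ v∉S = v∉S

  ⊆-antisym : ∀ {N} {S T : VSet N} → S ⊆ T → T ⊆ S → ∀ v → S v ≡ T v
  ⊆-antisym {S = S} {T} S⊆T T⊆S v with true-or-false (S v) | true-or-false (T v)
  ... | inj₁ x | inj₁ y = trans x (sym y)
  ... | inj₁ x | inj₂ y = ⊥-elim (true≢false (S⊆T v x) y)
  ... | inj₂ x | inj₁ y = ⊥-elim (true≢false (T⊆S v y) x)
  ... | inj₂ x | inj₂ y = trans x (sym y)

  leastWitness : ∀ {p} (P : ℕ → Set p) → (∀ k → Dec (P k)) → ∀ n → P n →
                 Σ ℕ λ k → P k × (∀ j → P j → k ≤ j)
  leastWitness P P? zero    pn = 0 , pn , λ _ _ → z≤n
  leastWitness P P? (suc n) pn with P? 0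
  ... | yes p0 = 0 , p0 , λ _ _ → z≤n
  ... | no ¬p0 with leastWitness (λ j → P (suc j)) (λ j → P? (suc j)) n pn
  ... | k , pk , least = suc k , pk , λ where
    zero    pj → ⊥-elim (¬p0 pj)
    (suc j) pj → s≤s (least j pj)

  argmin : ∀ {N} (S : VSet N) (f : Fin N → ℕ) → (∃ λ x → x ∈ S) →
           Σ (Fin N) λ g → g ∈ S × (∀ w → w ∈ S → f g ≤ f w)
  argmin {N} S f (x , xS) with leastWitness Attained attained? (f x) (x , xS , refl)
    where
    Attained : ℕ → Set
    Attained k = Σ (Fin N) λ w → w ∈ S × f w ≡ k
    attained? : ∀ k → Dec (Attained k)
    attained? k = Finₚ.any? λ w → attainedAt w
      where
      attainedAt : ∀ w → Dec (w ∈ S × f w ≡ k)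
      attainedAt w with S w | f w Nat.≟ k
      ... | true  | yes e = yes (refl , e)
      ... | true  | no ne = no λ p → ne (proj₂ p)
      ... | false | _     = no λ { (() , _) }
  ... | _ , (g , gS , refl) , least = g , gS , λ w wS → least (f w) (w , wS , refl)

open VertexSets

module Walks {N : ℕ} (G : Graph N) where
  open ≡ using (refl; sym; trans; cong; subst)
  open Graph G using (adj; irrefl)
  open Nat using (_+_)

  private variable
    P Q : VSet N
    u v w x y z : Fin N
    k l : ℕ

  adj-sym : adj u v ≡ true → adj v u ≡ true
  adj-sym {u = u} {v = v} e = trans (Graph.sym G v u) e

  adj⇒≢ : adj u v ≡ true → ¬ u ≡ v
  adj⇒≢ {u = u} e refl = true≢false e (irrefl u)

  head∈ : Walk G P u v k → u ∈ P
  head∈ (here p)     = p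
  head∈ (step p _ _) = p

  last∈ : Walk G P u v k → v ∈ P
  last∈ (here p)     = p
  last∈ (step _ _ ω) = last∈ ω

  _++ʷ_ : Walk G P u w k → Walk G P w v l → Walk G P u v (k + l)
  here _     ++ʷ ω₂ = ω₂
  step p a ω ++ʷ ω₂ = step p a (ω ++ʷ ω₂)

  snocʷ : Walk G P u w k → adj w v ≡ true → v ∈ P → Walk G P u v (suc k)
  snocʷ {k = k} ω a vP = subst (Walk G _ _ _) (ℕₚ.+-comm k 1) (ω ++ʷ step (last∈ ω) a (here vP))

  reverseʷ : Walk G P u v k → Walk G P v u k
  reverseʷ (here p)     = here p
  reverseʷ (step p a ω) = snocʷ (reverseʷ ω) (adj-sym a) p

  widen : P ⊆ Q → Walk G P u v k → Walk G Q u v k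
  widen P⊆Q (here p)     = here (P⊆Q _ p)
  widen P⊆Q (step p a ω) = step (P⊆Q _ p) a (widen P⊆Q ω)

  walk₀⇒≡ : Walk G P u v 0 → u ≡ v
  walk₀⇒≡ (here _) = refl

  walk₁⇒adj : Walk G P u v 1 → adj u v ≡ true
  walk₁⇒adj (step _ a (here _)) = a

  firstStep : Walk G P u v k → ¬ u ≡ v →
              Σ (Fin N) λ w → adj u w ≡ true × Σ ℕ λ k′ → Walk G P w v k′ × suc k′ ≡ k
  firstStep (here _)     u≢v = ⊥-elim (u≢v refl)
  firstStep (step _ a ω) _   = _ , a , _ , ω , refl

  walk⇒length≥1 : Walk G P u v k → ¬ u ≡ v → 1 ≤ k
  walk⇒length≥1 (here _)     u≢v = ⊥-elim (u≢v refl)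
  walk⇒length≥1 (step _ _ _) _   = s≤s z≤n

  support : Walk G P u v k → VSet N
  support {u = u} (here _)     y = does (y ≟ u)
  support {u = u} (step _ _ ω) y = does (y ≟ u) ∨ support ω y

  head∈support : (ω : Walk G P u v k) → u ∈ support ω
  head∈support {u = u} (here _)     = ≟-refl u
  head∈support {u = u} (step _ _ ω) = ∨-introˡ _ (≟-refl u)

  support-tail : (p : u ∈ P) (a : adj u w ≡ true) (ω : Walk G P w v k) → support ω ⊆ support (step p a ω)
  support-tail {u = u} _ _ ω x x∈ = ∨-introʳ (does (x ≟ u)) x∈

  support⊆ : (ω : Walk G P u v k) → support ω ⊆ P
  support⊆ {P = P} {u = u} (here p) y e = subst (_∈ P) (sym (≟-true y u e)) p
  support⊆ {P = P} {u = u} (step p a ω) y e with ∨-elim e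
  ... | inj₁ e₁ = subst (_∈ P) (sym (≟-true y u e₁)) p
  ... | inj₂ e₂ = support⊆ ω y e₂

  restrict : (ω : Walk G P u v k) → support ω ⊆ Q → Walk G Q u v k
  restrict {u = u} (here p)     s = here (s u (≟-refl u))
  restrict {u = u} (step p a ω) s =
    step (s u (∨-introˡ _ (≟-refl u))) a (restrict ω (λ y e → s y (support-tail p a ω y e)))

  suffixFrom : (ω : Walk G P u v k) → x ∈ support ω →
               Σ ℕ λ j → j ≤ k × Σ (Walk G P x v j) λ ω′ → support ω′ ⊆ support ω
  suffixFrom {u = u} {x = x} (here p) e with refl ← ≟-true x u e = 0 , z≤n , here p , λ _ e′ → e′
  suffixFrom {u = u} {x = x} (step p a ω) e with ∨-elim e
  ... | inj₁ e₁ with refl ← ≟-true x u e₁ = _ , ℕₚ.≤-refl , step p a ω , λ _ e′ → e′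
  ... | inj₂ e₂ with suffixFrom ω e₂
  ... | j , j≤k , ω′ , s = j , ℕₚ.m≤n⇒m≤1+n j≤k , ω′ , λ y e′ → ∨-introʳ _ (s y e′)

  suffixWithin : (ω : Walk G P u v k) → x ∈ support ω → Σ ℕ λ j → Walk G (support ω) x v j
  suffixWithin ω e with suffixFrom ω e
  ... | j , _ , ω′ , s = j , restrict ω′ s

  prefixWithin : (ω : Walk G P u v k) → x ∈ support ω → Σ ℕ λ j → Walk G (support ω) x u j
  prefixWithin {u = u} {x = x} (here p) e with refl ← ≟-true x u e = 0 , here (≟-refl x)
  prefixWithin {u = u} {x = x} (step p a ω) e with x ≟ u
  ... | yes refl = 0 , here (∨-introˡ _ (≟-refl x))
  ... | no _ with prefixWithin ω e
  ... | j , ω′ = suc j , snocʷ (widen (support-tail p a ω) ω′) (adj-sym a) (∨-introˡ _ (≟-refl u))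

  walk? : ∀ P k u v → Dec (Walk G P u v k)
  walk? P zero u v with u ≟ v | true-or-false (P u)
  ... | yes refl | inj₁ uP = yes (here uP)
  ... | yes refl | inj₂ uP = no λ { (here p) → true≢false p uP }
  ... | no u≢v   | _       = no λ { (here p) → u≢v refl }
  walk? P (suc k) u v with true-or-false (P u) | Finₚ.any? firstStep?
    where
    firstStep? : ∀ w → Dec (adj u w ≡ true × Walk G P w v k)
    firstStep? w with adj u w | walk? P k w v
    ... | true  | yes ω = yes (refl , ω)
    ... | true  | no ¬ω = no λ s → ¬ω (proj₂ s)
    ... | false | _     = no λ { (() , _) }
  ... | inj₂ uP | _ = no λ { (step p _ _) → true≢false p uP }
  ... | inj₁ uP | yes (w , a , ω) = yes (step uP a ω)
  ... | inj₁ uP | no ¬s = no λ { (step {w = w} _ a ω) → ¬s (w , a , ω) }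

  shortestWalk : Walk G P u v k → Σ ℕ λ d → Walk G P u v d × (∀ j → Walk G P u v j → d ≤ j)
  shortestWalk {P = P} {u = u} {v = v} {k = k} ω = leastWitness (Walk G P u v) (λ j → walk? P j u v) k ω

  Simple : Walk G P u v k → Set
  Simple (here _)                 = ⊤
  Simple {u = u} (step _ _ ω) = support ω u ≡ false × Simple ω

  minimal⇒simple : (ω : Walk G P u v k) → (∀ j → Walk G P u v j → k ≤ j) → Simple ω
  minimal⇒simple (here _) _ = tt
  minimal⇒simple {u = u} (step p a ω) minimal =
    head∉tail , minimal⇒simple ω (λ j ω′ → ℕₚ.≤-pred (minimal (suc j) (step p a ω′)))
    where
    head∉tail : support ω u ≡ false
    head∉tail with true-or-false (support ω u)
    ... | inj₂ u∉ = u∉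
    ... | inj₁ u∈ with suffixFrom ω u∈
    ... | j , j≤k , ω′ , _ = ⊥-elim (ℕₚ.≤⇒≯ j≤k (minimal j ω′))

  route : (ω : Walk G P u v k) → Simple ω → y ∈ support ω → ¬ y ≡ z →
          (Σ ℕ λ j → Walk G (support ω ─ z) y u j) ⊎ (Σ ℕ λ j → Walk G (support ω ─ z) y v j)
  route {P = P} {u = u} {y = y} (here p) _ e y≢z with refl ← ≟-true y u e =
    inj₁ (0 , here (∈-─⁺ {S = support (here {P = P} p)} (≟-refl y) y≢z))
  route {u = u} {y = y} {z = z} (step p a ω) (u∉ω , simple) e y≢z with z ≟ u
  ... | yes refl = inj₂ (j , restrict ω′ avoids)
    where
    y∈ω : y ∈ support ω
    y∈ω with ∨-elim {does (y ≟ z)} e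
    ... | inj₁ y≡z = ⊥-elim (y≢z (≟-true y z y≡z))
    ... | inj₂ y∈  = y∈
    j = proj₁ (suffixFrom ω y∈ω)
    ω′ = proj₁ (proj₂ (proj₂ (suffixFrom ω y∈ω)))
    avoids : support ω′ ⊆ (support (step p a ω) ─ z)
    avoids x x∈ = let x∈ω = proj₂ (proj₂ (proj₂ (suffixFrom ω y∈ω))) x x∈ in
      ∈-─⁺ {S = support (step p a ω)} (support-tail p a ω x x∈ω) (∉⇒≢ x∈ω u∉ω)
  ... | no z≢u with y ≟ u
  ... | yes refl = inj₁ (0 , here (∈-─⁺ {S = support (step p a ω)} (∨-introˡ _ (≟-refl y)) y≢z))
  ... | no _ with route ω simple e y≢z
  ... | inj₁ (j , ω′) = inj₁ (suc j , snocʷ (widen (─-mono (support-tail p a ω)) ω′) (adj-sym a)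
                                  (∈-─⁺ {S = support (step p a ω)} (∨-introˡ _ (≟-refl u)) (z≢u ∘ sym)))
  ... | inj₂ (j , ω′) = inj₂ (j , widen (─-mono (support-tail p a ω)) ω′)

  notIn : VSet N → VSet N
  notIn S y = not (S y)

  firstEntry : (S : VSet N) → Walk G P x v k → v ∈ S → S x ≡ false →
               Σ (Fin N) λ b′ → Σ (Fin N) λ b → Σ ℕ λ j →
                 Walk G (notIn S) x b′ j × adj b′ b ≡ true × b ∈ S × b ∈ P
  firstEntry S (here _) vS xS = ⊥-elim (true≢false vS xS)
  firstEntry {x = x} S (step {w = y} p a ω) vS xS with true-or-false (S y)
  ... | inj₁ yS = x , y , 0 , here (cong not xS) , a , yS , head∈ ω
  ... | inj₂ yS with firstEntry S ω vS yS
  ... | b′ , b , j , ω₁ , a₁ , bS , bP = b′ , b , suc j , step (cong not xS) a ω₁ , a₁ , bS , bP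

  data Tail (S : VSet N) (w′ v : Fin N) : ℕ → Set where
    tail0 : w′ ≡ v → Tail S w′ v 0
    tailS : ∀ {a′ k} → adj w′ a′ ≡ true → Walk G (notIn S) a′ v k → Tail S w′ v (suc k)

  lastExit : (S : VSet N) → Walk G P x v k →
             Walk G (notIn S) x v k ⊎
             (Σ (Fin N) λ w′ → Σ ℕ λ k₁ → Σ ℕ λ k₂ →
               w′ ∈ S × k₁ + k₂ ≡ k × Walk G P x w′ k₁ × Tail S w′ v k₂)
  lastExit {x = x} S (here p) with true-or-false (S x)
  ... | inj₁ xS = inj₂ (x , 0 , 0 , xS , refl , here p , tail0 refl)
  ... | inj₂ xS = inj₁ (here (cong not xS))
  lastExit {x = x} S (step p a ω) with lastExit S ω
  ... | inj₂ (w′ , k₁ , k₂ , w′S , eq , ω₁ , t) =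
        inj₂ (w′ , suc k₁ , k₂ , w′S , cong suc eq , step p a ω₁ , t)
  ... | inj₁ ω₁ with true-or-false (S x)
  ... | inj₁ xS = inj₂ (x , 0 , _ , xS , refl , here p , tailS a ω₁)
  ... | inj₂ xS = inj₁ (step (cong not xS) a ω₁)

module Counting where
  open ≡ using (refl; sym; trans; cong)

  count≤ : ∀ {n} (f : Fin n → Bool) → countℕ f ≤ n
  count≤ {zero}  f = z≤n
  count≤ {suc n} f with f zero
  ... | true  = s≤s (count≤ (λ i → f (suc i)))
  ... | false = ℕₚ.m≤n⇒m≤1+n (count≤ (λ i → f (suc i)))

  count-mono : ∀ {n} (f g : Fin n → Bool) → (∀ i → f i ≡ true → g i ≡ true) → countℕ f ≤ countℕ g
  count-mono {zero}  f g f⊆g = z≤n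
  count-mono {suc n} f g f⊆g with f zero in ef | g zero in eg
  ... | true  | true  = s≤s (count-mono _ _ (λ i → f⊆g (suc i)))
  ... | true  | false = ⊥-elim (true≢false (f⊆g zero ef) eg)
  ... | false | true  = ℕₚ.m≤n⇒m≤1+n (count-mono _ _ (λ i → f⊆g (suc i)))
  ... | false | false = count-mono _ _ (λ i → f⊆g (suc i))

  count-remove : ∀ {n} (S : Fin n → Bool) i → S i ≡ true → countℕ S ≡ suc (countℕ (S ─ i))
  count-remove {suc n} S zero e rewrite e = cong suc (sym (rest (λ i → S (suc i))))
    where
    rest : ∀ {m} (T : Fin m → Bool) → countℕ (λ i → T i ∧ not (does (suc i ≟ zero {m}))) ≡ countℕ T
    rest {zero}  T = refl
    rest {suc m} T with T zero
    ... | true  = cong suc (rest (λ i → T (suc i)))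
    ... | false = rest (λ i → T (suc i))
  count-remove {suc n} S (suc i) e with S zero
  ... | true  = cong suc (count-remove (λ j → S (suc j)) i e)
  ... | false = count-remove (λ j → S (suc j)) i e

  count-strict : ∀ {n} (f g : Fin n → Bool) → (∀ i → f i ≡ true → g i ≡ true) →
                 ∀ v → g v ≡ true → f v ≡ false → countℕ f < countℕ g
  count-strict f g f⊆g v gv fv =
    ≡.subst (countℕ f <_) (sym (count-remove g v gv)) (s≤s (count-mono f (g ─ v) f⊆g─v))
    where
    f⊆g─v : ∀ i → f i ≡ true → (g ─ v) i ≡ true
    f⊆g─v i fi = ∈-─⁺ {S = g} (f⊆g i fi) (∉⇒≢ fi fv)

  count-zero : ∀ {n} (f : Fin n → Bool) → (∀ i → f i ≡ false) → countℕ f ≡ 0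
  count-zero {zero}  f none = refl
  count-zero {suc n} f none rewrite none zero = count-zero (λ i → f (suc i)) (λ i → none (suc i))

  count-one : ∀ {n} (f : Fin n → Bool) → (Σ (Fin n) λ i → f i ≡ true) →
              (∀ i j → f i ≡ true → f j ≡ true → i ≡ j) → countℕ f ≡ 1
  count-one f (i , fi) unique = trans (count-remove f i fi) (cong suc (count-zero (f ─ i) others))
    where
    others : ∀ j → (f ─ i) j ≡ false
    others j with true-or-false ((f ─ i) j)
    ... | inj₂ e = e
    ... | inj₁ e = ⊥-elim (∈-─⁻ʳ {S = f} e (unique j i (∈-─⁻ˡ {S = f} e) fi))

open Counting

module Blocks {N : ℕ} (G : Graph N) where
  open ≡ using (refl; sym; trans; cong; subst)
  open Graph G using (adj)
  open Walks G
  open Nat using (_+_)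
  open import Relation.Nullary.Decidable.Core using (¬¬-excluded-middle)

  private variable
    P S T : VSet N
    a b a′ b′ z : Fin N
    k : ℕ

  connectedOn-hub : ∀ {h} → h ∈ P → (∀ x → x ∈ P → Σ ℕ λ k → Walk G P x h k) → ConnectedOn G P
  connectedOn-hub hP toHub u v uP vP with toHub u uP | toHub v vP
  ... | k₁ , ω₁ | k₂ , ω₂ = k₁ + k₂ , ω₁ ++ʷ reverseʷ ω₂

  biconn-─ : Biconn G S → ∀ z → ConnectedOn G (S ─ z)
  biconn-─ {S = S} (_ , connS , cut) z with true-or-false (S z)
  ... | inj₁ zS = cut z zS
  ... | inj₂ zS = λ u v uP vP →
    let k , ω = connS u v (∈-─⁻ˡ {S = S} uP) (∈-─⁻ˡ {S = S} vP)
    in  k , widen (λ y yS → ∈-─⁺ {S = S} yS (∉⇒≢ yS zS)) ω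

  module Ear (biS : Biconn G S) (aS : a ∈ S) (bS : b ∈ S) (a≢b : ¬ a ≡ b)
             (aa′ : adj a a′ ≡ true) (b′b : adj b′ b ≡ true)
             (ω : Walk G (notIn S) a′ b′ k) (simple : Simple ω) where

    T′ : VSet N
    T′ = S ∪ support ω

    inS : ∀ {y} → y ∈ S → y ∈ T′
    inS = ∈-∪⁺ˡ {S = S} {T = support ω}

    inω : ∀ {y} → y ∈ support ω → y ∈ T′
    inω = ∈-∪⁺ʳ {S = S} {T = support ω}

    ω∩S : ∀ {y} → y ∈ support ω → S y ≡ false
    ω∩S {y} y∈ω = not-injective (support⊆ ω y y∈ω)

    connS = proj₁ (proj₂ biS)

    connected : ConnectedOn G T′
    connected = connectedOn-hub (inS aS) toA
      where
      toA : ∀ x → x ∈ T′ → Σ ℕ λ j → Walk G T′ x a j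
      toA x xT with ∈-∪⁻ {S = S} {T = support ω} xT
      ... | inj₁ xS = let j , ω′ = connS x a xS aS in j , widen (λ _ → inS) ω′
      ... | inj₂ xω = let j , ω′ = prefixWithin ω xω in
                      suc j , snocʷ (widen (λ _ → inω) ω′) (adj-sym aa′) (inS aS)

    module _ {z} (zS : z ∈ S) where

      ω⊆T′─z : support ω ⊆ (T′ ─ z)
      ω⊆T′─z y y∈ = ∈-─⁺ {S = T′} (inω y∈) (∉⇒≢ zS (ω∩S y∈) ∘ sym)

      viaHubInS : ∀ {h} → h ∈ S → ¬ h ≡ z → (∀ x → x ∈ support ω → Σ ℕ λ j → Walk G (T′ ─ z) x h j) →
                  ConnectedOn G (T′ ─ z)
      viaHubInS {h} hS h≢z fromω = connectedOn-hub (∈-─⁺ {S = T′} (inS hS) h≢z) toH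
        where
        toH : ∀ x → x ∈ (T′ ─ z) → Σ ℕ λ j → Walk G (T′ ─ z) x h j
        toH x xT with ∈-∪⁻ {S = S} {T = support ω} (∈-─⁻ˡ {S = T′} xT)
        ... | inj₂ xω = fromω x xω
        ... | inj₁ xS = let j , ω′ = biconn-─ biS z x h (∈-─⁺ {S = S} xS (∈-─⁻ʳ {S = T′} xT)) (∈-─⁺ {S = S} hS h≢z)
                        in  j , widen (─-mono (λ _ → inS)) ω′

      cutInS : ConnectedOn G (T′ ─ z)
      cutInS with a ≟ z
      ... | no a≢z = viaHubInS aS a≢z λ x xω → let j , ω′ = prefixWithin ω xω in
        suc j , snocʷ (widen ω⊆T′─z ω′) (adj-sym aa′) (∈-─⁺ {S = T′} (inS aS) a≢z)
      ... | yes refl = viaHubInS bS (a≢b ∘ sym) λ x xω → let j , ω′ = suffixWithin ω xω in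
        suc j , snocʷ (widen ω⊆T′─z ω′) b′b (∈-─⁺ {S = T′} (inS bS) (a≢b ∘ sym))

    -- Since ω is simple, every remaining vertex of ω still reaches a′ or b′ without passing z.
    cutOutsideS : S z ≡ false → ConnectedOn G (T′ ─ z)
    cutOutsideS {z} zS = connectedOn-hub (S⊆ aS) toA
      where
      S⊆ : ∀ {y} → y ∈ S → y ∈ (T′ ─ z)
      S⊆ yS = ∈-─⁺ {S = T′} (inS yS) (∉⇒≢ yS zS)
      ω⊆ : (support ω ─ z) ⊆ (T′ ─ z)
      ω⊆ = ─-mono (λ _ → inω)
      toA : ∀ x → x ∈ (T′ ─ z) → Σ ℕ λ j → Walk G (T′ ─ z) x a j
      toA x xT with ∈-∪⁻ {S = S} {T = support ω} (∈-─⁻ˡ {S = T′} xT)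
      ... | inj₁ xS = let j , ω′ = connS x a xS aS in j , widen (λ _ → S⊆) ω′
      ... | inj₂ xω with route ω simple xω (∈-─⁻ʳ {S = T′} xT)
      ... | inj₁ (j , ω′) = suc j , snocʷ (widen ω⊆ ω′) (adj-sym aa′) (S⊆ aS)
      ... | inj₂ (j , ω′) = let j′ , ω″ = connS b a bS aS in
                            suc j + j′ , snocʷ (widen ω⊆ ω′) b′b (S⊆ bS) ++ʷ widen (λ _ → S⊆) ω″

    biconn : Biconn G T′
    biconn = (a , inS aS) , connected , cut
      where
      cut : ∀ z → z ∈ T′ → ConnectedOn G (T′ ─ z)
      cut z _ with true-or-false (S z)
      ... | inj₁ zS = cutInS zS
      ... | inj₂ zS = cutOutsideS zS

  -- A shortest such walk is simple, so it would be an ear enlarging the block.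
  noBypass : IsBlock G S → a ∈ S → b ∈ S → ¬ a ≡ b → adj a a′ ≡ true → adj b′ b ≡ true →
             Walk G (notIn S) a′ b′ k → ⊥
  noBypass {S = S} {a′ = a′} (biS , maximal) aS bS a≢b aa′ b′b ω₀ =
    true≢false (maximal E.T′ (λ _ → E.inS) E.biconn a′ (E.inω (head∈support ω))) (not-injective (head∈ ω))
    where
    shortest = shortestWalk ω₀
    ω = proj₁ (proj₂ shortest)
    module E = Ear biS aS bS a≢b aa′ b′b ω (minimal⇒simple ω (proj₂ (proj₂ shortest)))

  biconn-∪ : Biconn G S → Biconn G T → a ∈ S → a ∈ T → b ∈ S → b ∈ T → ¬ a ≡ b → Biconn G (S ∪ T)
  biconn-∪ {S = S} {T = T} {a = a} {b = b} biS biT aS aT bS bT a≢b =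
    (a , inS aS) , connectedOn-hub (inS aS) toA , cut
    where
    inS : ∀ {y} → y ∈ S → y ∈ (S ∪ T)
    inS = ∈-∪⁺ˡ {S = S} {T = T}
    inT : ∀ {y} → y ∈ T → y ∈ (S ∪ T)
    inT = ∈-∪⁺ʳ {S = S} {T = T}
    toA : ∀ x → x ∈ (S ∪ T) → Σ ℕ λ j → Walk G (S ∪ T) x a j
    toA x xU with ∈-∪⁻ {S = S} {T = T} xU
    ... | inj₁ xS = let j , ω = proj₁ (proj₂ biS) x a xS aS in j , widen (λ _ → inS) ω
    ... | inj₂ xT = let j , ω = proj₁ (proj₂ biT) x a xT aT in j , widen (λ _ → inT) ω
    cut : ∀ z → z ∈ (S ∪ T) → ConnectedOn G ((S ∪ T) ─ z)
    cut z _ = connectedOn-hub (∈-─⁺ {S = S ∪ T} (inS hS) h≢z) toH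
      where
      common : Σ (Fin N) λ h → h ∈ S × h ∈ T × ¬ h ≡ z
      common with a ≟ z
      ... | no a≢z   = a , aS , aT , a≢z
      ... | yes refl = b , bS , bT , a≢b ∘ sym
      h = proj₁ common
      hS = proj₁ (proj₂ common)
      hT = proj₁ (proj₂ (proj₂ common))
      h≢z = proj₂ (proj₂ (proj₂ common))
      toH : ∀ x → x ∈ ((S ∪ T) ─ z) → Σ ℕ λ j → Walk G ((S ∪ T) ─ z) x h j
      toH x x∈ with ∈-∪⁻ {S = S} {T = T} (∈-─⁻ˡ {S = S ∪ T} x∈)
      ... | inj₁ xS = let j , ω = biconn-─ biS z x h (∈-─⁺ {S = S} xS (∈-─⁻ʳ {S = S ∪ T} x∈)) (∈-─⁺ {S = S} hS h≢z)
                      in  j , widen (─-mono (λ _ → inS)) ω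
      ... | inj₂ xT = let j , ω = biconn-─ biT z x h (∈-─⁺ {S = T} xT (∈-─⁻ʳ {S = S ∪ T} x∈)) (∈-─⁺ {S = T} hT h≢z)
                      in  j , widen (─-mono (λ _ → inT)) ω

  blocks-sharing-two-vertices-coincide :
    IsBlock G S → IsBlock G T → a ∈ S → a ∈ T → b ∈ S → b ∈ T → ¬ a ≡ b → ∀ v → S v ≡ T v
  blocks-sharing-two-vertices-coincide {S = S} {T = T} (biS , maxS) (biT , maxT) aS aT bS bT a≢b =
    ⊆-antisym (λ v vS → T∪S⊆T v (∈-∪⁺ʳ {S = T} {T = S} vS)) (λ v vT → S∪T⊆S v (∈-∪⁺ʳ {S = S} {T = T} vT))
    where
    S∪T⊆S = maxS (S ∪ T) (λ _ → ∈-∪⁺ˡ {S = S} {T = T}) (biconn-∪ biS biT aS aT bS bT a≢b)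
    T∪S⊆T = maxT (T ∪ S) (λ _ → ∈-∪⁺ˡ {S = T} {T = S}) (biconn-∪ biT biS aT aS bT bS a≢b)

  -- Constructively only doubly negated: maximality is not decidable, so we enlarge while possible,
  -- with N ∸ |T| as the termination measure.
  extendToBlock : Biconn G T → ¬ ¬ (Σ (VSet N) λ S → IsBlock G S × T ⊆ S)
  extendToBlock {T = T} = go N (ℕₚ.m∸n≤m N (countℕ T))
    where
    go : ∀ n {T} → N ∸ countℕ T ≤ n → Biconn G T → ¬ ¬ (Σ (VSet N) λ S → IsBlock G S × T ⊆ S)
    go n {T} bound biT noBlock = ¬¬-excluded-middle decide
      where
      Larger = Σ (VSet N) λ T′ → Biconn G T′ × T ⊆ T′ × Σ (Fin N) λ v → v ∈ T′ × T v ≡ false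
      maximal : ¬ Larger → ∀ T′ → T ⊆ T′ → Biconn G T′ → T′ ⊆ T
      maximal noLarger T′ T⊆T′ biT′ v vT′ with true-or-false (T v)
      ... | inj₁ vT = vT
      ... | inj₂ vT = ⊥-elim (noLarger (T′ , biT′ , T⊆T′ , v , vT′ , vT))
      larger : ∀ n → N ∸ countℕ T ≤ n → ∀ T′ → Biconn G T′ → T ⊆ T′ → countℕ T < countℕ T′ → ⊥
      larger n bound T′ biT′ T⊆T′ grows with ℕₚ.≤-trans (ℕₚ.∸-monoʳ-< grows (count≤ T′)) bound
      larger zero    _ _ _ _ _ | ()
      larger (suc n) _ T′ biT′ T⊆T′ _ | s≤s bound′ =
        go n bound′ biT′ λ (S , blockS , T′⊆S) → noBlock (S , blockS , λ x x∈ → T′⊆S x (T⊆T′ x x∈))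
      decide : Dec Larger → ⊥
      decide (no noLarger) = noBlock (T , (biT , maximal noLarger) , λ _ v∈ → v∈)
      decide (yes (T′ , biT′ , T⊆T′ , v , vT′ , vT)) = larger n bound T′ biT′ T⊆T′ (count-strict T T′ T⊆T′ v vT′ vT)

module BiBlockDistances {N r : ℕ} (G : Graph N) (D : BiBlock G r) where
  open ≡ using (refl; sym; trans; cong; cong₂; subst)
  open Graph G using (adj)
  open BiBlock D
  open Walks G
  open Blocks G
  open Nat using (_+_)

  private variable
    P : VSet N
    u v w x : Fin N
    i j : Fin r
    k : ℕ

  B : Fin r → VSet N
  B i = X i ∪ Y i

  opaque
    shortestFrom : ∀ u v → Σ ℕ λ d → Walk G full u v d × (∀ j → Walk G full u v j → d ≤ j)
    shortestFrom u v = shortestWalk (proj₂ (connected u v refl refl))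

    dist : Fin N → Fin N → ℕ
    dist u v = proj₁ (shortestFrom u v)

    geodesic : ∀ u v → Walk G full u v (dist u v)
    geodesic u v = proj₁ (proj₂ (shortestFrom u v))

    dist-minimal : Walk G full u v k → dist u v ≤ k
    dist-minimal {u = u} {v = v} {k = k} ω = proj₂ (proj₂ (shortestFrom u v)) k ω

  dist-isDist : ∀ u v → Dist G u v (dist u v)
  dist-isDist u v = geodesic u v , λ k ω → dist-minimal ω

  dist-triangle : ∀ u v w → dist u w ≤ dist u v + dist v w
  dist-triangle u v w = dist-minimal (geodesic u v ++ʷ geodesic v w)

  dist≡0⇒≡ : dist u v ≡ 0 → u ≡ v
  dist≡0⇒≡ {u = u} {v = v} e = walk₀⇒≡ (subst (Walk G full u v) e (geodesic u v))

  dist-refl : ∀ u → dist u u ≡ 0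
  dist-refl u = ℕₚ.n≤0⇒n≡0 (dist-minimal (here {P = full} refl))

  adj⇒dist≡1 : adj u v ≡ true → dist u v ≡ 1
  adj⇒dist≡1 {u = u} {v = v} a = ℕₚ.≤-antisym (dist-minimal (step refl a (here refl))) atLeast1
    where
    atLeast1 : 1 ≤ dist u v
    atLeast1 with dist u v in e
    ... | zero  = ⊥-elim (adj⇒≢ a (dist≡0⇒≡ e))
    ... | suc _ = s≤s z≤n

  commonNeighbour⇒dist≡2 : ¬ u ≡ v → adj u v ≡ false → adj u w ≡ true → adj w v ≡ true → dist u v ≡ 2
  commonNeighbour⇒dist≡2 {u = u} {v = v} u≢v ¬uv uw wv =
    ℕₚ.≤-antisym (dist-minimal (step refl uw (step refl wv (here refl)))) atLeast2
    where
    atLeast2 : 2 ≤ dist u v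
    atLeast2 with dist u v in e
    ... | zero        = ⊥-elim (u≢v (dist≡0⇒≡ e))
    ... | suc zero    = ⊥-elim (true≢false (walk₁⇒adj (subst (Walk G full u v) e (geodesic u v))) ¬uv)
    ... | suc (suc _) = s≤s (s≤s z≤n)

  record Sides (i : Fin r) (O Q : VSet N) : Set where
    field
      O⊆B        : O ⊆ B i
      Q⊆B        : Q ⊆ B i
      B⊆O∪Q      : ∀ w → w ∈ B i → w ∈ O ⊎ w ∈ Q
      O∩Q=∅      : ∀ {w} → w ∈ O → w ∈ Q → ⊥
      O-nonempty : ∃ λ w → w ∈ O
      Q-nonempty : ∃ λ w → w ∈ Q
      adj-OQ     : ∀ {w w′} → w ∈ O → w′ ∈ Q → adj w w′ ≡ true
      ¬adj-OO    : ∀ {w w′} → w ∈ O → w′ ∈ O → adj w w′ ≡ false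
      ¬adj-QQ    : ∀ {w w′} → w ∈ Q → w′ ∈ Q → adj w w′ ≡ false

    dist-OQ : ∀ {w w′} → w ∈ O → w′ ∈ Q → dist w w′ ≡ 1
    dist-OQ wO w′Q = adj⇒dist≡1 (adj-OQ wO w′Q)

    dist-QO : ∀ {w w′} → w ∈ Q → w′ ∈ O → dist w w′ ≡ 1
    dist-QO wQ w′O = adj⇒dist≡1 (adj-sym (adj-OQ w′O wQ))

    dist-OO : ∀ {w w′} → w ∈ O → w′ ∈ O → ¬ w ≡ w′ → dist w w′ ≡ 2
    dist-OO wO w′O w≢w′ = let y , yQ = Q-nonempty in
      commonNeighbour⇒dist≡2 w≢w′ (¬adj-OO wO w′O) (adj-OQ wO yQ) (adj-sym (adj-OQ w′O yQ))

    dist-QQ : ∀ {w w′} → w ∈ Q → w′ ∈ Q → ¬ w ≡ w′ → dist w w′ ≡ 2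
    dist-QQ wQ w′Q w≢w′ = let x , xO = O-nonempty in
      commonNeighbour⇒dist≡2 w≢w′ (¬adj-QQ wQ w′Q) (adj-sym (adj-OQ xO wQ)) (adj-OQ xO w′Q)

    Q-false : ∀ {w} → w ∈ O → Q w ≡ false
    Q-false {w} wO with true-or-false (Q w)
    ... | inj₁ wQ = ⊥-elim (O∩Q=∅ wO wQ)
    ... | inj₂ w∉Q = w∉Q

    adj-in-block : ∀ {u} → u ∈ O → ∀ w → (adj u w ∧ B i u ∧ B i w) ≡ Q w
    adj-in-block {u} uO w = trans (cong (λ b → adj u w ∧ b ∧ B i w) (O⊆B u uO)) adj∧B
      where
      adj∧B : (adj u w ∧ B i w) ≡ Q w
      adj∧B with true-or-false (B i w)
      ... | inj₂ w∉B = trans (cong (adj u w ∧_) w∉B) (trans (∧-zeroʳ (adj u w)) (sym (⊆⇒∉ Q⊆B w∉B)))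
      ... | inj₁ w∈B with B⊆O∪Q w w∈B
      ...   | inj₁ wO = trans (cong (_∧ B i w) (¬adj-OO uO wO)) (sym (Q-false wO))
      ...   | inj₂ wQ = trans (cong₂ _∧_ (adj-OQ uO wQ) w∈B) (sym wQ)

    nonadjacent-same-side : ∀ {u} → u ∈ O → ∀ w →
      (not (does (u ≟ w)) ∧ not (adj u w) ∧ O u ∧ O w) ≡ (O ─ u) w
    nonadjacent-same-side {u} uO w = trans (cong (λ b → not (does (u ≟ w)) ∧ not (adj u w) ∧ b ∧ O w) uO) onO
      where
      onO : (not (does (u ≟ w)) ∧ not (adj u w) ∧ O w) ≡ (O ─ u) w
      onO with true-or-false (O w)
      ... | inj₁ wO rewrite wO | ¬adj-OO uO wO =
        trans (∧-identityʳ _) (cong not (does-⇔ (mk⇔ sym sym) (u ≟ w) (w ≟ u)))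
      ... | inj₂ w∉O rewrite w∉O | ∧-zeroʳ (not (adj u w)) = ∧-zeroʳ _

    nonadjacent-other-side : ∀ {u} → u ∈ O → ∀ w → (not (does (u ≟ w)) ∧ not (adj u w) ∧ Q u ∧ Q w) ≡ false
    nonadjacent-other-side {u} uO w =
      trans (cong (λ b → not (does (u ≟ w)) ∧ not (adj u w) ∧ b ∧ Q w) (Q-false uO))
            (trans (cong (not (does (u ≟ w)) ∧_) (∧-zeroʳ (not (adj u w)))) (∧-zeroʳ _))

  module _ (i : Fin r) where
    private
      X⊆B : X i ⊆ B i
      X⊆B _ = ∈-∪⁺ˡ {S = X i} {T = Y i}
      Y⊆B : Y i ⊆ B i
      Y⊆B _ = ∈-∪⁺ʳ {S = X i} {T = Y i}

      adj-XY : w ∈ X i → x ∈ Y i → adj w x ≡ true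
      adj-XY {w} {x} wX xY = Equivalence.from (bipartite i w x (X⊆B w wX) (Y⊆B x xY)) (inj₁ (wX , xY))

      ¬adj-X : w ∈ X i → x ∈ X i → adj w x ≡ false
      ¬adj-X {w} {x} wX xX with true-or-false (adj w x)
      ... | inj₂ ¬wx = ¬wx
      ... | inj₁ wx with Equivalence.to (bipartite i w x (X⊆B w wX) (X⊆B x xX)) wx
      ...   | inj₁ (_ , xY) = ⊥-elim (disjoint i x xX xY)
      ...   | inj₂ (wY , _) = ⊥-elim (disjoint i w wX wY)

      ¬adj-Y : w ∈ Y i → x ∈ Y i → adj w x ≡ false
      ¬adj-Y {w} {x} wY xY with true-or-false (adj w x)
      ... | inj₂ ¬wx = ¬wx
      ... | inj₁ wx with Equivalence.to (bipartite i w x (Y⊆B w wY) (Y⊆B x xY)) wx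
      ...   | inj₁ (wX , _) = ⊥-elim (disjoint i w wX wY)
      ...   | inj₂ (_ , xX) = ⊥-elim (disjoint i x xX xY)

    sidesXY : Sides i (X i) (Y i)
    sidesXY = record
      { O⊆B = X⊆B ; Q⊆B = Y⊆B ; B⊆O∪Q = λ _ → ∈-∪⁻ {S = X i} {T = Y i} ; O∩Q=∅ = disjoint i _
      ; O-nonempty = X-nonempty i ; Q-nonempty = Y-nonempty i
      ; adj-OQ = adj-XY
      ; ¬adj-OO = ¬adj-X ; ¬adj-QQ = ¬adj-Y
      }

    sidesYX : Sides i (Y i) (X i)
    sidesYX = record
      { O⊆B = Y⊆B ; Q⊆B = X⊆B ; B⊆O∪Q = λ w w∈ → swap (∈-∪⁻ {S = X i} {T = Y i} w∈)
      ; O∩Q=∅ = λ wY wX → disjoint i _ wX wY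
      ; O-nonempty = Y-nonempty i ; Q-nonempty = X-nonempty i
      ; adj-OQ = λ wY w′X → adj-sym (adj-XY w′X wY)
      ; ¬adj-OO = ¬adj-Y ; ¬adj-QQ = ¬adj-X
      }

  opaque
    nearest : ∀ i v → Σ (Fin N) λ g → g ∈ B i × (∀ w → w ∈ B i → dist g v ≤ dist w v)
    nearest i v = argmin (B i) (λ w → dist w v) (proj₁ (X-nonempty i) , Sides.O⊆B (sidesXY i) _ (proj₂ (X-nonempty i)))

    gate : Fin r → Fin N → Fin N
    gate i v = proj₁ (nearest i v)

    gate∈B : ∀ i v → gate i v ∈ B i
    gate∈B i v = proj₁ (proj₂ (nearest i v))

    gate-nearest : ∀ i v w → w ∈ B i → dist (gate i v) v ≤ dist w v
    gate-nearest i v = proj₂ (proj₂ (nearest i v))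

  gate-self : ∀ i v → v ∈ B i → gate i v ≡ v
  gate-self i v vB = dist≡0⇒≡ (ℕₚ.n≤0⇒n≡0 (ℕₚ.≤-trans (gate-nearest i v v vB) (ℕₚ.≤-reflexive (dist-refl v))))

  tail⇒dist≤ : ∀ {S} → Tail S w v k → dist w v ≤ k
  tail⇒dist≤ (tail0 refl) = ℕₚ.≤-reflexive (dist-refl _)
  tail⇒dist≤ (tailS a ω)  = dist-minimal (step refl a (widen (λ _ _ → refl) ω))

  leaveBlock⇒gate : w ∈ B i → Tail (B i) w v k → w ≡ gate i v
  leaveBlock⇒gate {w = w} {i = i} {v = v} wB t with w ≟ gate i v
  ... | yes w≡g = w≡g
  ... | no w≢g = ⊥-elim (impossible t)
    where
    impossible : Tail (B i) w v k → ⊥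
    impossible (tail0 refl) = w≢g (sym (gate-self i w wB))
    impossible (tailS wa′ ωa) with lastExit (B i) (geodesic (gate i v) v)
    ... | inj₁ ω = true≢false (gate∈B i v) (not-injective (head∈ ω))
    ... | inj₂ (_ , _ , _ , g′B , _ , _ , tail0 refl) = true≢false g′B (not-injective (last∈ ωa))
    ... | inj₂ (g′ , k₁ , k₂ , g′B , k₁+k₂≡ , ω₁ , tailS g′b ωb) with g′ ≟ gate i v
    ...   | yes refl = noBypass (isBlock i) wB (gate∈B i v) w≢g wa′ (adj-sym g′b) (ωa ++ʷ reverseʷ ωb)
    ...   | no g′≢g = ℕₚ.<-irrefl refl (ℕₚ.≤-<-trans (gate-nearest i v g′ g′B) closer)
      where
      closer : dist g′ v < dist (gate i v) v
      closer = ℕₚ.≤-<-trans (tail⇒dist≤ (tailS {S = B i} g′b ωb))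
                 (subst (k₂ <_) k₁+k₂≡ (ℕₚ.+-monoˡ-≤ k₂ (walk⇒length≥1 ω₁ (g′≢g ∘ sym))))

  dist-via-gate : ∀ i v w → w ∈ B i → dist w v ≡ dist w (gate i v) + dist (gate i v) v
  dist-via-gate i v w wB = ℕₚ.≤-antisym (dist-triangle w (gate i v) v) viaGate
    where
    viaGate : dist w (gate i v) + dist (gate i v) v ≤ dist w v
    viaGate with lastExit (B i) (geodesic w v)
    ... | inj₁ ω = ⊥-elim (true≢false wB (not-injective (head∈ ω)))
    ... | inj₂ (w′ , k₁ , k₂ , w′B , k₁+k₂≡ , ω₁ , t) with refl ← leaveBlock⇒gate w′B t =
      subst (dist w (gate i v) + dist (gate i v) v ≤_) k₁+k₂≡ (ℕₚ.+-mono-≤ (dist-minimal ω₁) (tail⇒dist≤ t))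

  module _ {i O Q} (sides : Sides i O Q) where
    open Sides sides

    closerNeighbour : u ∈ O → ¬ gate i v ≡ u → Σ (Fin N) λ w → w ∈ B i × adj u w ≡ true × dist w v < dist u v
    closerNeighbour {u = u} {v = v} uO g≢u with B⊆O∪Q _ (gate∈B i v)
    ... | inj₂ gQ = gate i v , gate∈B i v , adj-OQ uO gQ , closer
      where
      closer : dist (gate i v) v < dist u v
      closer rewrite dist-via-gate i v u (O⊆B u uO) | dist-OQ uO gQ = ℕₚ.≤-refl
    ... | inj₁ gO = y , Q⊆B y yQ , adj-OQ uO yQ , closer
      where
      y = proj₁ Q-nonempty
      yQ = proj₂ Q-nonempty
      closer : dist y v < dist u v
      closer rewrite dist-via-gate i v u (O⊆B u uO) | dist-via-gate i v y (Q⊆B y yQ)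
                   | dist-OO uO gO (g≢u ∘ sym) | dist-QO yQ gO = ℕₚ.≤-refl

  nearer⇒gate≢ : w ∈ B i → dist w v < dist u v → ¬ gate i v ≡ u
  nearer⇒gate≢ {w = w} {i = i} {v = v} wB closer refl =
    ℕₚ.<-irrefl refl (ℕₚ.≤-<-trans (gate-nearest i v w wB) closer)

  sidesOf : u ∈ B i → Σ (VSet N) λ O → Σ (VSet N) λ Q → Sides i O Q × u ∈ O
  sidesOf {i = i} uB with ∈-∪⁻ {S = X i} {T = Y i} uB
  ... | inj₁ uX = X i , Y i , sidesXY i , uX
  ... | inj₂ uY = Y i , X i , sidesYX i , uY

  -- Block i lies on u's way to v: u ∈ B i but u is not the gate of B i towards v.
  towards : Fin N → Fin N → Fin r → Bool
  towards u v i = B i u ∧ not (does (gate i v ≟ u))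

  towards⁻ : towards u v i ≡ true → u ∈ B i × ¬ gate i v ≡ u
  towards⁻ {u = u} {v = v} {i = i} e = ∧-elimˡ e , ≟-false (gate i v) u (not-injective (∧-elimʳ {B i u} e))

  towards⁺ : u ∈ B i → ¬ gate i v ≡ u → towards u v i ≡ true
  towards⁺ {u = u} {i = i} {v = v} uB g≢u = ∧-intro uB (cong not (dec-false (gate i v ≟ u) g≢u))

  avoiding : ∀ u {v x} → dist x v < dist u v → Walk G (λ y → not (does (y ≟ u))) x v (dist x v)
  avoiding u {v} {x} closer = restrict (geodesic x v) avoidsU
    where
    avoidsU : ∀ y → y ∈ support (geodesic x v) → not (does (y ≟ u)) ≡ true
    avoidsU y y∈ with y ≟ u
    ... | no _ = refl
    ... | yes refl with suffixFrom (geodesic x v) y∈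
    ...   | j , j≤ , ω , _ = ⊥-elim (ℕₚ.<-irrefl refl (ℕₚ.<-≤-trans closer (ℕₚ.≤-trans (dist-minimal ω) j≤)))

  closerNeighbourOf : towards u v i ≡ true → Σ (Fin N) λ w → w ∈ B i × adj u w ≡ true × dist w v < dist u v
  closerNeighbourOf {i = i} t = let uB , g≢u = towards⁻ {i = i} t
                                    _ , _ , sides , uO = sidesOf uB
                                in  closerNeighbour sides uO g≢u

  -- Two such blocks would give, through their closer neighbours of u, a walk around u
  -- re-entering the second block, which noBypass forbids.
  towards-unique : ∀ u v i j → towards u v i ≡ true → towards u v j ≡ true → i ≡ j
  towards-unique u v i j ti tj with i ≟ j
  ... | yes i≡j = i≡j
  ... | no i≢j with closerNeighbourOf {i = i} ti | closerNeighbourOf {i = j} tj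
  ... | wi , wiBi , u~wi , wi-closer | wj , wjBj , _ , wj-closer = ⊥-elim bypass
    where
    uBi = proj₁ (towards⁻ {i = i} ti)
    uBj = proj₁ (towards⁻ {i = j} tj)
    wi∉Bj : B j wi ≡ false
    wi∉Bj with true-or-false (B j wi)
    ... | inj₂ e = e
    ... | inj₁ wiBj = ⊥-elim (i≢j (distinct i j
                        (blocks-sharing-two-vertices-coincide (isBlock i) (isBlock j) uBi uBj wiBi wiBj (adj⇒≢ u~wi))))
    around : Walk G (λ y → not (does (y ≟ u))) wi wj _
    around = avoiding u wi-closer ++ʷ reverseʷ (avoiding u wj-closer)
    bypass : ⊥
    bypass with firstEntry (B j) around wjBj wi∉Bj
    ... | b′ , b , _ , ω , b′b , bB , b≢u =
      noBypass (isBlock j) uBj bB (λ u≡b → ≟-false b u (not-injective b≢u) (sym u≡b)) u~wi b′b ω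

  edge : Fin N → Fin N → VSet N
  edge u w x = does (x ≟ u) ∨ does (x ≟ w)

  edge-biconn : adj u w ≡ true → Biconn G (edge u w)
  edge-biconn {u = u} {w = w} uw =
    (u , ∨-introˡ _ (≟-refl u)) , connectedEdge (edge u w) ends ,
    λ z _ → connectedEdge (edge u w ─ z) (λ x x∈ → ends x (∧-elimˡ x∈))
    where
    ends : ∀ x → x ∈ edge u w → x ≡ u ⊎ x ≡ w
    ends x x∈ with ∨-elim {does (x ≟ u)} x∈
    ... | inj₁ e = inj₁ (≟-true x u e)
    ... | inj₂ e = inj₂ (≟-true x w e)
    connectedEdge : ∀ Q → (∀ x → x ∈ Q → x ≡ u ⊎ x ≡ w) → ConnectedOn G Q
    connectedEdge Q inEdge x y xQ yQ with x ≟ y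
    ... | yes refl = 0 , here xQ
    ... | no x≢y with inEdge x xQ | inEdge y yQ
    ...   | inj₁ refl | inj₁ refl = ⊥-elim (x≢y refl)
    ...   | inj₁ refl | inj₂ refl = 1 , step xQ uw (here yQ)
    ...   | inj₂ refl | inj₁ refl = 1 , step xQ (adj-sym uw) (here yQ)
    ...   | inj₂ refl | inj₂ refl = ⊥-elim (x≢y refl)

  -- The block containing the first edge of a geodesic from u to v.
  towards-exists : ∀ u v → ¬ u ≡ v → ¬ ¬ (Σ (Fin r) λ i → towards u v i ≡ true)
  towards-exists u v u≢v none with firstStep (geodesic u v) u≢v
  ... | w , uw , _ , ω , len = extendToBlock (edge-biconn uw) λ (S , blockS , edge⊆S) →
    let i , S≡Bi = complete S blockS
        inBi : ∀ x → x ∈ edge u w → x ∈ B i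
        inBi x x∈ = trans (sym (S≡Bi x)) (edge⊆S x x∈)
        closer = ℕₚ.≤-<-trans (dist-minimal ω) (ℕₚ.≤-reflexive len)
    in none (i , towards⁺ (inBi u (∨-introˡ _ (≟-refl u)))
                          (nearer⇒gate≢ (inBi w (∨-introʳ (does (w ≟ u)) (≟-refl w))) closer))

  count-towards-≢ : ¬ u ≡ v → countℕ (towards u v) ≡ 1
  count-towards-≢ {u = u} {v = v} u≢v with countℕ (towards u v) Nat.≟ 1
  ... | yes one = one
  ... | no ¬one = ⊥-elim (towards-exists u v u≢v λ ex → ¬one (count-one (towards u v) ex (towards-unique u v)))

  count-towards-self : ∀ u → countℕ (towards u u) ≡ 0
  count-towards-self u = count-zero (towards u u) none
    where
    none : ∀ i → towards u u i ≡ false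
    none i with true-or-false (towards u u i)
    ... | inj₂ e = e
    ... | inj₁ e = let uB , g≢u = towards⁻ {i = i} e in ⊥-elim (g≢u (gate-self i u uB))

-- Algebra.Solver.Ring needs coefficients with decidable equality mapped into R; ℤ is the initial ring.

module IntegerCoefficients {a ℓ : Level} (R : CommutativeRing a ℓ) where
  open CommutativeRing R
  open import Algebra.Properties.Ring ring using (-‿involutive; -‿distribˡ-*; -‿distribʳ-*; -0#≈0#; -‿+-comm)
  open import Algebra.Properties.CommutativeSemigroup +-commutativeSemigroup using (interchange)
  open import Algebra.Properties.Semiring.Mult.TCOptimised semiring using (×-homo-+; ×1-homo-*)
    renaming (_×_ to _×′_)
  import Algebra.Solver.Ring.AlmostCommutativeRing as ACR
  open import Data.Integer using (ℤ; +_; -[1+_]; _⊖_; sign; ∣_∣; _◃_; +-*-rawRing)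
    renaming (_+_ to _+ℤ_; _*_ to _*ℤ_; -_ to -ℤ_; _≟_ to _≟ℤ_)
  open import Data.Integer.Properties using ([1+m]⊖[1+n]≡m⊖n)
  open import Data.Maybe using (Maybe; just; nothing)
  open import Data.Sign as Sign using (Sign)
  open import Relation.Binary.Reasoning.Setoid setoid

  fromℤ : ℤ → Carrier
  fromℤ (+ n)      = n ×′ 1#
  fromℤ (-[1+ n ]) = - (suc n ×′ 1#)

  private
    suc-homo : ∀ n → suc n ×′ 1# ≈ 1# + n ×′ 1#
    suc-homo n = ×-homo-+ 1# 1 n

    cancelˡ : ∀ c x y → (c + x) - (c + y) ≈ x - y
    cancelˡ c x y = begin
      (c + x) - (c + y)     ≈⟨ +-congˡ (sym (-‿+-comm c y)) ⟩
      (c + x) + (- c - y)   ≈⟨ interchange c x (- c) (- y) ⟩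
      (c - c) + (x - y)     ≈⟨ +-congʳ (-‿inverseʳ c) ⟩
      0# + (x - y)          ≈⟨ +-identityˡ _ ⟩
      x - y                 ∎

  ⊖-homo : ∀ m n → fromℤ (m ⊖ n) ≈ m ×′ 1# - n ×′ 1#
  ⊖-homo m       zero    = sym (trans (+-congˡ -0#≈0#) (+-identityʳ _))
  ⊖-homo zero    (suc n) = sym (+-identityˡ _)
  ⊖-homo (suc m) (suc n) = begin
    fromℤ (suc m ⊖ suc n)           ≡⟨ ≡.cong fromℤ ([1+m]⊖[1+n]≡m⊖n m n) ⟩
    fromℤ (m ⊖ n)                   ≈⟨ ⊖-homo m n ⟩
    m ×′ 1# - n ×′ 1#               ≈⟨ cancelˡ 1# _ _ ⟨
    (1# + m ×′ 1#) - (1# + n ×′ 1#) ≈⟨ +-cong (suc-homo m) (-‿cong (suc-homo n)) ⟨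
    suc m ×′ 1# - suc n ×′ 1#       ∎

  +-homo : ∀ i j → fromℤ (i +ℤ j) ≈ fromℤ i + fromℤ j
  +-homo -[1+ m ] -[1+ n ] = begin
    - (suc (suc (m Nat.+ n)) ×′ 1#)   ≡⟨ ≡.cong (λ k → - (suc k ×′ 1#)) (ℕₚ.+-suc m n) ⟨
    - ((suc m Nat.+ suc n) ×′ 1#)     ≈⟨ -‿cong (×-homo-+ 1# (suc m) (suc n)) ⟩
    - (suc m ×′ 1# + suc n ×′ 1#)     ≈⟨ -‿+-comm _ _ ⟨
    - (suc m ×′ 1#) - suc n ×′ 1#     ∎
  +-homo -[1+ m ] (+ n)    = trans (⊖-homo n (suc m)) (+-comm _ _)
  +-homo (+ m)    -[1+ n ] = ⊖-homo m (suc n)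
  +-homo (+ m)    (+ n)    = ×-homo-+ 1# m n

  -‿homo : ∀ i → fromℤ (-ℤ i) ≈ - fromℤ i
  -‿homo (+ zero)    = sym -0#≈0#
  -‿homo (+ suc n)   = refl
  -‿homo -[1+ n ]    = sym (-‿involutive _)

  private
    signed : Sign → Carrier → Carrier
    signed Sign.+ x = x
    signed Sign.- x = - x

    ◃-homo : ∀ s n → fromℤ (s ◃ n) ≈ signed s (n ×′ 1#)
    ◃-homo Sign.+ zero    = refl
    ◃-homo Sign.- zero    = sym -0#≈0#
    ◃-homo Sign.+ (suc n) = refl
    ◃-homo Sign.- (suc n) = refl

    signed-abs : ∀ i → fromℤ (i) ≈ signed (sign i) (∣ i ∣ ×′ 1#)
    signed-abs (+ _)      = refl
    signed-abs -[1+ _ ]   = refl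

    signed-cong : ∀ s {x y} → x ≈ y → signed s x ≈ signed s y
    signed-cong Sign.+ e = e
    signed-cong Sign.- e = -‿cong e

    signed-* : ∀ s t x y → signed (s Sign.* t) (x * y) ≈ signed s x * signed t y
    signed-* Sign.+ Sign.+ x y = refl
    signed-* Sign.+ Sign.- x y = -‿distribʳ-* x y
    signed-* Sign.- Sign.+ x y = -‿distribˡ-* x y
    signed-* Sign.- Sign.- x y = begin
      x * y             ≈⟨ -‿involutive _ ⟨
      - - (x * y)       ≈⟨ -‿cong (-‿distribʳ-* x y) ⟩
      - (x * - y)       ≈⟨ -‿distribˡ-* x (- y) ⟩
      - x * - y         ∎

  *-homo : ∀ i j → fromℤ (i *ℤ j) ≈ fromℤ (i) * fromℤ (j)
  *-homo i j = begin
    fromℤ (s ◃ ∣ i ∣ Nat.* ∣ j ∣)                          ≈⟨ ◃-homo s (∣ i ∣ Nat.* ∣ j ∣) ⟩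
    signed s ((∣ i ∣ Nat.* ∣ j ∣) ×′ 1#)               ≈⟨ signed-cong s (×1-homo-* ∣ i ∣ ∣ j ∣) ⟩
    signed s (∣ i ∣ ×′ 1# * ∣ j ∣ ×′ 1#)               ≈⟨ signed-* (sign i) (sign j) _ _ ⟩
    signed (sign i) (∣ i ∣ ×′ 1#) * signed (sign j) (∣ j ∣ ×′ 1#) ≈⟨ *-cong (signed-abs i) (signed-abs j) ⟨
    fromℤ (i) * fromℤ (j)                                        ∎
    where s = sign i Sign.* sign j

  morphism : +-*-rawRing ACR.-Raw-AlmostCommutative⟶ ACR.fromCommutativeRing R
  morphism = record
    { ⟦_⟧ = fromℤ ; +-homo = +-homo ; *-homo = *-homo ; -‿homo = -‿homo ; 0-homo = refl ; 1-homo = refl }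

  coefficients≟ : ∀ i j → Maybe (fromℤ (i) ≈ fromℤ (j))
  coefficients≟ i j with i ≟ℤ j
  ... | yes ≡.refl = just refl
  ... | no _       = nothing

  open import Algebra.Solver.Ring +-*-rawRing (ACR.fromCommutativeRing R) morphism coefficients≟ public
    using (Polynomial; solve; _:+_; _:*_; _:-_; :-_; _:=_; con)

module Sums {a ℓ : Level} (R : CommutativeRing a ℓ) where
  open CommutativeRing R hiding (zero)
  open Matrices R
  open import Algebra.Properties.Semiring.Sum semiring
    using (sum; sum-cong-≋; ∑-distrib-+; ∑-comm; *-distribˡ-sum; *-distribʳ-sum)
  open import Relation.Binary.Reasoning.Setoid setoid

  private
    Σ≈sum : ∀ {n} (f : Fin n → Carrier) → Σ[ f ] ≈ sum f
    Σ≈sum {zero}  f = refl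
    Σ≈sum {suc n} f = +-congˡ (Σ≈sum (λ i → f (suc i)))

  Σ-cong : ∀ {n} {f g : Fin n → Carrier} → (∀ i → f i ≈ g i) → Σ[ f ] ≈ Σ[ g ]
  Σ-cong {f = f} {g} f≈g = trans (Σ≈sum f) (trans (sum-cong-≋ f≈g) (sym (Σ≈sum g)))

  Σ-distrib-+ : ∀ {n} (f g : Fin n → Carrier) → Σ[ (λ i → f i + g i) ] ≈ Σ[ f ] + Σ[ g ]
  Σ-distrib-+ f g = trans (Σ≈sum (λ i → f i + g i)) (trans (∑-distrib-+ f g) (sym (+-cong (Σ≈sum f) (Σ≈sum g))))

  *-distribˡ-Σ : ∀ {n} x (f : Fin n → Carrier) → x * Σ[ f ] ≈ Σ[ (λ i → x * f i) ]
  *-distribˡ-Σ x f = trans (*-congˡ (Σ≈sum f)) (trans (*-distribˡ-sum x f) (sym (Σ≈sum (λ i → x * f i))))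

  *-distribʳ-Σ : ∀ {n} (f : Fin n → Carrier) x → Σ[ f ] * x ≈ Σ[ (λ i → f i * x) ]
  *-distribʳ-Σ f x = trans (*-congʳ (Σ≈sum f)) (trans (*-distribʳ-sum x f) (sym (Σ≈sum (λ i → f i * x))))

  Σ-comm : ∀ {n m} (f : Fin n → Fin m → Carrier) →
           Σ[ (λ i → Σ[ (λ j → f i j) ]) ] ≈ Σ[ (λ j → Σ[ (λ i → f i j) ]) ]
  Σ-comm f = begin
    Σ[ (λ i → Σ[ (λ j → f i j) ]) ]  ≈⟨ Σ-cong (λ i → Σ≈sum (f i)) ⟩
    Σ[ (λ i → sum (f i)) ]           ≈⟨ Σ≈sum (λ i → sum (f i)) ⟩
    sum (λ i → sum (f i))            ≈⟨ ∑-comm f ⟩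
    sum (λ j → sum (λ i → f i j))    ≈⟨ Σ≈sum (λ j → sum (λ i → f i j)) ⟨
    Σ[ (λ j → sum (λ i → f i j)) ]   ≈⟨ Σ-cong (λ j → Σ≈sum (λ i → f i j)) ⟨
    Σ[ (λ j → Σ[ (λ i → f i j) ]) ]  ∎

  Σ-Σ-*ʳ : ∀ {n m} (f : Fin n → Fin m → Carrier) (g : Fin m → Carrier) →
           Σ[ (λ j → Σ[ (λ i → f i j) ] * g j) ] ≈ Σ[ (λ i → Σ[ (λ j → f i j * g j) ]) ]
  Σ-Σ-*ʳ f g = trans (Σ-cong (λ j → *-distribʳ-Σ (λ i → f i j) (g j))) (Σ-comm (λ j i → f i j * g j))

  Σ-zero : ∀ {n} (f : Fin n → Carrier) → (∀ i → f i ≈ 0#) → Σ[ f ] ≈ 0#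
  Σ-zero {zero}  f f≈0 = refl
  Σ-zero {suc n} f f≈0 = trans (+-cong (f≈0 zero) (Σ-zero _ (λ i → f≈0 (suc i)))) (+-identityʳ 0#)

  Σ-+-scaled : ∀ {n} (f g : Fin n → Carrier) x → Σ[ (λ i → f i + x * g i) ] ≈ Σ[ f ] + x * Σ[ g ]
  Σ-+-scaled f g x = trans (Σ-distrib-+ f (λ i → x * g i)) (+-congˡ (sym (*-distribˡ-Σ x g)))

  Σ-linear₃ : ∀ {n} x y z (f g h : Fin n → Carrier) →
              Σ[ (λ i → x * f i + y * g i + z * h i) ] ≈ x * Σ[ f ] + y * Σ[ g ] + z * Σ[ h ]
  Σ-linear₃ x y z f g h =
    trans (Σ-+-scaled _ h z) (+-congʳ (trans (Σ-+-scaled _ g y) (+-congʳ (sym (*-distribˡ-Σ x f)))))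

  [-]-*ʳ : ∀ b x y → [ b ] x * y ≈ [ b ] (x * y)
  [-]-*ʳ true  x y = refl
  [-]-*ʳ false x y = zeroˡ y

  [-]-*ˡ : ∀ b x y → [ b ] (x * y) ≈ x * [ b ] y
  [-]-*ˡ true  x y = refl
  [-]-*ˡ false x y = sym (zeroʳ x)

  [-]-cong : ∀ b {x y} → x ≈ y → [ b ] x ≈ [ b ] y
  [-]-cong true  e = e
  [-]-cong false e = refl

  [-]-≡ : ∀ {b b′} x → b ≡ b′ → [ b ] x ≈ [ b′ ] x
  [-]-≡ x ≡.refl = refl

  Σ-indicator : ∀ {n} (S : Fin n → Bool) (a f : Fin n → Carrier) x → (∀ i → a i ≈ [ S i ] x) →
                Σ[ (λ i → a i * f i) ] ≈ x * Σ[ (λ i → [ S i ] (f i)) ]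
  Σ-indicator S a f x a≈ = trans (Σ-cong (λ i → trans (*-congʳ (a≈ i)) (trans ([-]-*ʳ (S i) x (f i)) ([-]-*ˡ (S i) x (f i)))))
                                 (sym (*-distribˡ-Σ x (λ i → [ S i ] (f i))))

  Σ-δ : ∀ {n} (u : Fin n) (f : Fin n → Carrier) → Σ[ (λ w → [ δ u w ] (f w)) ] ≈ f u
  Σ-δ {suc n} zero f = trans (+-congˡ (Σ-zero {n} _ (λ _ → refl))) (+-identityʳ (f zero))
  Σ-δ {suc n} (suc u) f = trans (+-identityˡ _) (trans (Σ-cong shift) (Σ-δ u (λ i → f (suc i))))
    where
    shift : ∀ w → [ δ (suc u) (suc w) ] (f (suc w)) ≈ [ δ u w ] (f (suc w))
    shift w with u ≟ w
    ... | yes _ = refl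
    ... | no _  = refl

  Σ-δ′ : ∀ {n} (u : Fin n) (f : Fin n → Carrier) → Σ[ (λ w → [ δ w u ] (f w)) ] ≈ f u
  Σ-δ′ u f = trans (Σ-cong (λ w → [-]-≡ (f w) (δ-sym w u))) (Σ-δ u f)
    where
    δ-sym : ∀ w u → δ w u ≡ δ u w
    δ-sym w u = does-⇔ (mk⇔ ≡.sym ≡.sym) (w ≟ u) (u ≟ w)

  Σ-over-const : ∀ {n} (S : Fin n → Bool) (f : Fin n → Carrier) x → (∀ w → S w ≡ true → f w ≈ x) →
                 Σ[ (λ w → [ S w ] (f w)) ] ≈ ℕ→R (countℕ S) * x
  Σ-over-const {zero}  S f x f≈x = sym (zeroˡ x)
  Σ-over-const {suc n} S f x f≈x with S zero in e
  ... | true  = trans (+-cong (f≈x zero e) (Σ-over-const _ _ x (λ i → f≈x (suc i))))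
                      (sym (trans (distribʳ x 1# _) (+-congʳ (*-identityˡ x))))
  ... | false = trans (+-identityˡ _) (Σ-over-const _ _ x (λ i → f≈x (suc i)))

  Σ-over-remove : ∀ {n} (S : Fin n → Bool) (f : Fin n → Carrier) g → S g ≡ true →
                  Σ[ (λ w → [ S w ] (f w)) ] ≈ f g + Σ[ (λ w → [ (S ─ g) w ] (f w)) ]
  Σ-over-remove S f g gS =
    trans (Σ-cong split) (trans (Σ-distrib-+ (λ w → [ δ w g ] (f w)) _) (+-congʳ (Σ-δ′ g f)))
    where
    split : ∀ w → [ S w ] (f w) ≈ [ δ w g ] (f w) + [ (S ─ g) w ] (f w)
    split w with w ≟ g
    ... | yes ≡.refl rewrite gS = sym (+-identityʳ _)
    ... | no _ with S w
    ...   | true  = sym (+-identityˡ _)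
    ...   | false = sym (+-identityˡ _)

  ℕ→R-count : ∀ {n} (S : Fin n → Bool) → ℕ→R (countℕ S) ≈ Σ[ (λ i → [ S i ] 1#) ]
  ℕ→R-count {zero}  S = refl
  ℕ→R-count {suc n} S with S zero
  ... | true  = +-congˡ (ℕ→R-count (λ i → S (suc i)))
  ... | false = trans (ℕ→R-count (λ i → S (suc i))) (sym (+-identityˡ _))

  ℕ→R-* : ∀ m n → ℕ→R (m Nat.* n) ≈ ℕ→R m * ℕ→R n
  ℕ→R-* zero    n = sym (zeroˡ _)
  ℕ→R-* (suc m) n = begin
    ℕ→R (n Nat.+ m Nat.* n)       ≈⟨ ℕ→R-+ n (m Nat.* n) ⟩
    ℕ→R n + ℕ→R (m Nat.* n)       ≈⟨ +-cong (sym (*-identityˡ _)) (ℕ→R-* m n) ⟩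
    1# * ℕ→R n + ℕ→R m * ℕ→R n    ≈⟨ distribʳ _ _ _ ⟨
    (1# + ℕ→R m) * ℕ→R n          ∎
    where
    ℕ→R-+ : ∀ m n → ℕ→R (m Nat.+ n) ≈ ℕ→R m + ℕ→R n
    ℕ→R-+ zero    n = sym (+-identityˡ _)
    ℕ→R-+ (suc m) n = trans (+-congˡ (ℕ→R-+ m n)) (sym (+-assoc _ _ _))

  pow-+ : ∀ x j k → pow x (j Nat.+ k) ≈ pow x j * pow x k
  pow-+ x zero    k = sym (*-identityˡ _)
  pow-+ x (suc j) k = trans (*-congˡ (pow-+ x j k)) (sym (*-assoc _ _ _))

  module _ {N : ℕ} where

    ·-identityʳ : ∀ (A : Matrix N) → (A · I) ≈M A
    ·-identityʳ A u v = trans (Σ-cong (λ w → trans (*-comm _ _) (trans ([-]-*ʳ (δ w v) 1# _) ([-]-cong (δ w v) (*-identityˡ _)))))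
                              (Σ-δ′ v (A u))

    ·-identityˡ : ∀ (A : Matrix N) → (I · A) ≈M A
    ·-identityˡ A u v = trans (Σ-cong (λ w → trans ([-]-*ʳ (δ u w) 1# _) ([-]-cong (δ u w) (*-identityˡ _))))
                              (Σ-δ u (λ w → A w v))

    ·-assoc : ∀ (A B C : Matrix N) → ((A · B) · C) ≈M (A · (B · C))
    ·-assoc A B C u v = begin
      Σ[ (λ w → Σ[ (λ x → A u x * B x w) ] * C w v) ] ≈⟨ Σ-cong (λ w → *-distribʳ-Σ (λ x → A u x * B x w) (C w v)) ⟩
      Σ[ (λ w → Σ[ (λ x → A u x * B x w * C w v) ]) ] ≈⟨ Σ-comm (λ w x → A u x * B x w * C w v) ⟩
      Σ[ (λ x → Σ[ (λ w → A u x * B x w * C w v) ]) ] ≈⟨ Σ-cong (λ x → Σ-cong (λ w → *-assoc (A u x) (B x w) (C w v))) ⟩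
      Σ[ (λ x → Σ[ (λ w → A u x * (B x w * C w v)) ]) ] ≈⟨ Σ-cong (λ x → *-distribˡ-Σ (A u x) (λ w → B x w * C w v)) ⟨
      Σ[ (λ x → A u x * Σ[ (λ w → B x w * C w v) ]) ] ∎

    ·-congˡ : ∀ {A A′ : Matrix N} (B : Matrix N) → A ≈M A′ → (A · B) ≈M (A′ · B)
    ·-congˡ B A≈A′ u v = Σ-cong (λ w → *-congʳ (A≈A′ u w))

    ·-congʳ : ∀ (A : Matrix N) {B B′ : Matrix N} → B ≈M B′ → (A · B) ≈M (A · B′)
    ·-congʳ A B≈B′ u v = Σ-cong (λ w → *-congˡ (B≈B′ w v))

    right-inverse≈left-inverse : ∀ (L F M : Matrix N) → (L · F) ≈M I → (F · M) ≈M I → M ≈M L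
    right-inverse≈left-inverse L F M LF≈I FM≈I u v = begin
      M u v               ≈⟨ ·-identityˡ M u v ⟨
      (I · M) u v         ≈⟨ ·-congˡ M LF≈I u v ⟨
      ((L · F) · M) u v   ≈⟨ ·-assoc L F M u v ⟩
      (L · (F · M)) u v   ≈⟨ ·-congʳ L FM≈I u v ⟩
      (L · I) u v         ≈⟨ ·-identityʳ L u v ⟩
      L u v               ∎

module CandidateInverse {a ℓ : Level} (R : CommutativeRing a ℓ) {N r : ℕ} (G : Graph N) (D : BiBlock G r)
                        (q d : CommutativeRing.Carrier R) (c : Fin r → CommutativeRing.Carrier R) where
  open CommutativeRing R hiding (zero)
  open Matrices R
  open Formula G D q d c using (𝐀; 𝐁; μ; RHS; m; n)
  open Graph G using (adj)
  open BiBlock D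
  open BiBlockDistances G D
  open Sums R
  open IntegerCoefficients R
  open import Data.Integer using (+_)
  open import Relation.Binary.Reasoning.Setoid setoid

  expDist : Matrix N
  expDist w v = pow q (dist w v)

  InvertsBlockFactors : Set ℓ
  InvertsBlockFactors = ∀ i → c i * (1# - (q * q) * ℕ→R ((m i ∸ 1) Nat.* (n i ∸ 1))) ≈ 1#

  private
    one : ∀ {k} → Polynomial k
    one = con (+ 1)

    contributionᴾ : ∀ {k} (d q c β sQ sO pu : Polynomial k) → Polynomial k
    contributionᴾ d q c β sQ sO pu =
      (:- (d :* q)) :* (c :* sQ) :+ d :* (q :* q) :* ((c :* β) :* sO) :+ d :* (q :* q) :* ((c :* β :+ one) :* pu)

  -- One block K_{O,Q} through u ∈ O, with cᵢ standing for 1/(1 - q²(|O|-1)(|Q|-1)).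
  module BlockContribution {i : Fin r} {O Q : VSet N} (sides : Sides i O Q) {u : Fin N} (uO : u ∈ O)
                           (v : Fin N) (cᵢ : Carrier) where
    open Sides sides

    g = gate i v
    qᵍ = pow q (dist g v)
    α = ℕ→R (countℕ (O ─ u))
    β = ℕ→R (countℕ Q ∸ 1)

    p : Fin N → Carrier
    p w = expDist w v

    ΣQ ΣO : Carrier
    ΣQ = Σ[ (λ w → [ Q w ] (p w)) ]
    ΣO = Σ[ (λ w → [ (O ─ u) w ] (p w)) ]

    contribution : Carrier → Carrier → Carrier → Carrier
    contribution sQ sO pu = - (d * q) * (cᵢ * sQ) + d * (q * q) * ((cᵢ * β) * sO) + d * (q * q) * ((cᵢ * β + 1#) * pu)

    contribution-cong : ∀ {sQ sQ′ sO sO′ pu pu′} → sQ ≈ sQ′ → sO ≈ sO′ → pu ≈ pu′ →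
                        contribution sQ sO pu ≈ contribution sQ′ sO′ pu′
    contribution-cong eQ eO eu = +-cong (+-cong (*-congˡ (*-congˡ eQ)) (*-congˡ (*-congˡ eO))) (*-congˡ (*-congˡ eu))

    p-via-gate : ∀ w → w ∈ B i → p w ≈ pow q (dist w g) * qᵍ
    p-via-gate w wB = trans (reflexive (≡.cong (pow q) (dist-via-gate i v w wB))) (pow-+ q (dist w g) (dist g v))

    p-at-distance : ∀ {w} k → w ∈ B i → dist w g ≡ k → p w ≈ pow q k * qᵍ
    p-at-distance k wB dist≡k = trans (p-via-gate _ wB) (*-congʳ (reflexive (≡.cong (pow q) dist≡k)))

    Σ-at-distance : ∀ (S : VSet N) k → S ⊆ B i → (∀ {w} → w ∈ S → dist w g ≡ k) →
                    Σ[ (λ w → [ S w ] (p w)) ] ≈ ℕ→R (countℕ S) * (pow q k * qᵍ)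
    Σ-at-distance S k S⊆B atDistance =
      Σ-over-const S p (pow q k * qᵍ) λ w wS → p-at-distance k (S⊆B w wS) (atDistance wS)

    O─u⊆B : (O ─ u) ⊆ B i
    O─u⊆B w w∈ = O⊆B w (∈-─⁻ˡ {S = O} w∈)

    |Q|≈1+β : ℕ→R (countℕ Q) ≈ 1# + β
    |Q|≈1+β with count-remove Q (proj₁ Q-nonempty) (proj₂ Q-nonempty)
    ... | e rewrite e = refl

    module _ (hyp : cᵢ * (1# - (q * q) * (α * β)) ≈ 1#) where

      gate-is-u : g ≡ u → contribution ΣQ ΣO (p u) ≈ 0#
      gate-is-u g≡u = begin
        contribution ΣQ ΣO (p u)
          ≈⟨ contribution-cong (trans (Σ-at-distance Q 1 Q⊆B (λ wQ → ≡.trans (≡.cong (dist _) g≡u) (dist-QO wQ uO)))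
                                      (*-congʳ |Q|≈1+β))
                               (Σ-at-distance (O ─ u) 2 O─u⊆B (λ w∈ → ≡.trans (≡.cong (dist _) g≡u)
                                  (dist-OO (∈-─⁻ˡ {S = O} w∈) uO (∈-─⁻ʳ {S = O} w∈))))
                               (p-at-distance 0 (O⊆B u uO) (≡.trans (≡.cong (dist u) g≡u) (dist-refl u))) ⟩
        contribution ((1# + β) * (pow q 1 * qᵍ)) (α * (pow q 2 * qᵍ)) (pow q 0 * qᵍ)
          ≈⟨ solve 6 (λ d q c qᵍ α β →
               contributionᴾ d q c β ((one :+ β) :* ((q :* one) :* qᵍ)) (α :* ((q :* (q :* one)) :* qᵍ)) (one :* qᵍ)
               := d :* (q :* q) :* qᵍ :* (one :- c :* (one :- (q :* q) :* (α :* β)))) refl d q cᵢ qᵍ α β ⟩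
        d * (q * q) * qᵍ * (1# - cᵢ * (1# - (q * q) * (α * β)))
          ≈⟨ *-congˡ (trans (+-congˡ (-‿cong hyp)) (-‿inverseʳ 1#)) ⟩
        d * (q * q) * qᵍ * 0#
          ≈⟨ zeroʳ _ ⟩
        0# ∎

      gate-opposite : g ∈ Q → contribution ΣQ ΣO (p u) ≈ d * (q * q - 1#) * p u
      gate-opposite gQ = begin
        contribution ΣQ ΣO (p u)
          ≈⟨ contribution-cong ΣQ≈ (Σ-at-distance (O ─ u) 1 O─u⊆B (λ w∈ → dist-OQ (∈-─⁻ˡ {S = O} w∈) gQ)) pu≈ ⟩
        contribution (pow q 0 * qᵍ + β * (pow q 2 * qᵍ)) (α * (pow q 1 * qᵍ)) (pow q 1 * qᵍ)
          ≈⟨ solve 6 (λ d q c qᵍ α β →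
               contributionᴾ d q c β (one :* qᵍ :+ β :* ((q :* (q :* one)) :* qᵍ)) (α :* ((q :* one) :* qᵍ)) ((q :* one) :* qᵍ)
               := d :* q :* qᵍ :* (q :* q :- c :* (one :- (q :* q) :* (α :* β)))) refl d q cᵢ qᵍ α β ⟩
        d * q * qᵍ * (q * q - cᵢ * (1# - (q * q) * (α * β)))
          ≈⟨ *-congˡ (+-congˡ (-‿cong hyp)) ⟩
        d * q * qᵍ * (q * q - 1#)
          ≈⟨ solve 3 (λ d q qᵍ → d :* q :* qᵍ :* (q :* q :- one) := d :* (q :* q :- one) :* ((q :* one) :* qᵍ)) refl d q qᵍ ⟩
        d * (q * q - 1#) * (pow q 1 * qᵍ)
          ≈⟨ *-congˡ pu≈ ⟨
        d * (q * q - 1#) * p u ∎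
        where
        ΣQ≈ : ΣQ ≈ pow q 0 * qᵍ + β * (pow q 2 * qᵍ)
        ΣQ≈ = trans (Σ-over-remove Q p g gQ)
                (+-cong (p-at-distance 0 (Q⊆B g gQ) (dist-refl g))
                        (trans (Σ-at-distance (Q ─ g) 2 (λ w w∈ → Q⊆B w (∈-─⁻ˡ {S = Q} w∈))
                                  (λ w∈ → dist-QQ (∈-─⁻ˡ {S = Q} w∈) gQ (∈-─⁻ʳ {S = Q} w∈)))
                               (*-congʳ (reflexive (≡.cong (λ k → ℕ→R (k ∸ 1)) (≡.sym (count-remove Q g gQ)))))))
        pu≈ : p u ≈ pow q 1 * qᵍ
        pu≈ = p-at-distance 1 (O⊆B u uO) (dist-OQ uO gQ)

      gate-same-side : g ∈ O → ¬ g ≡ u → contribution ΣQ ΣO (p u) ≈ d * (q * q - 1#) * p u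
      gate-same-side gO g≢u = begin
        contribution ΣQ ΣO (p u)
          ≈⟨ contribution-cong (trans (Σ-at-distance Q 1 Q⊆B (λ wQ → dist-QO wQ gO)) (*-congʳ |Q|≈1+β)) ΣO≈ pu≈ ⟩
        contribution ((1# + β) * (pow q 1 * qᵍ)) (pow q 0 * qᵍ + α′ * (pow q 2 * qᵍ)) (pow q 2 * qᵍ)
          ≈⟨ solve 6 (λ d q c qᵍ α′ β →
               contributionᴾ d q c β ((one :+ β) :* ((q :* one) :* qᵍ)) (one :* qᵍ :+ α′ :* ((q :* (q :* one)) :* qᵍ))
                 ((q :* (q :* one)) :* qᵍ)
               := d :* (q :* q) :* qᵍ :* (q :* q :- c :* (one :- (q :* q) :* ((one :+ α′) :* β)))) refl d q cᵢ qᵍ α′ β ⟩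
        d * (q * q) * qᵍ * (q * q - cᵢ * (1# - (q * q) * ((1# + α′) * β)))
          ≈⟨ *-congˡ (+-congˡ (-‿cong (trans (*-congˡ (+-congˡ (-‿cong (*-congˡ (*-congʳ (sym α≈1+α′)))))) hyp))) ⟩
        d * (q * q) * qᵍ * (q * q - 1#)
          ≈⟨ solve 3 (λ d q qᵍ → d :* (q :* q) :* qᵍ :* (q :* q :- one) := d :* (q :* q :- one) :* ((q :* (q :* one)) :* qᵍ))
                     refl d q qᵍ ⟩
        d * (q * q - 1#) * (pow q 2 * qᵍ)
          ≈⟨ *-congˡ pu≈ ⟨
        d * (q * q - 1#) * p u ∎
        where
        g∈O─u : g ∈ (O ─ u)
        g∈O─u = ∈-─⁺ {S = O} gO g≢u
        α′ = ℕ→R (countℕ ((O ─ u) ─ g))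
        α≈1+α′ : α ≈ 1# + α′
        α≈1+α′ = reflexive (≡.cong ℕ→R (count-remove (O ─ u) g g∈O─u))
        ΣO≈ : ΣO ≈ pow q 0 * qᵍ + α′ * (pow q 2 * qᵍ)
        ΣO≈ = trans (Σ-over-remove (O ─ u) p g g∈O─u)
                (+-cong (p-at-distance 0 (O⊆B g gO) (dist-refl g))
                        (Σ-at-distance ((O ─ u) ─ g) 2 (λ w w∈ → O─u⊆B w (∈-─⁻ˡ {S = O ─ u} w∈))
                           (λ w∈ → dist-OO (∈-─⁻ˡ {S = O} (∈-─⁻ˡ {S = O ─ u} w∈)) gO (∈-─⁻ʳ {S = O ─ u} w∈))))
        pu≈ : p u ≈ pow q 2 * qᵍ
        pu≈ = p-at-distance 2 (O⊆B u uO) (dist-OO uO gO (g≢u ∘ ≡.sym))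

      contribution≈ : contribution ΣQ ΣO (p u) ≈ [ not (does (g ≟ u)) ] (d * (q * q - 1#) * p u)
      contribution≈ with g ≟ u
      ... | yes g≡u = gate-is-u g≡u
      ... | no g≢u with B⊆O∪Q g (gate∈B i v)
      ...   | inj₂ gQ = gate-opposite gQ
      ...   | inj₁ gO = gate-same-side gO g≢u

  module BlockRow (u v : Fin N) (i : Fin r) where
    p : Fin N → Carrier
    p w = expDist w v

    aᵢ bᵢ : Fin N → Carrier
    aᵢ w = [ adj u w ∧ B i u ∧ B i w ] (c i)
    bᵢ w = [ not (δ u w) ∧ not (adj u w) ∧ X i u ∧ X i w ] (c i * ℕ→R (n i ∸ 1))
         + [ not (δ u w) ∧ not (adj u w) ∧ Y i u ∧ Y i w ] (c i * ℕ→R (m i ∸ 1))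

    μᵢ : Carrier
    μᵢ = [ X i u ] (c i * ℕ→R (n i ∸ 1)) + [ Y i u ] (c i * ℕ→R (m i ∸ 1))

    Tᵢ : Carrier
    Tᵢ = - (d * q) * Σ[ (λ w → aᵢ w * p w) ] + d * (q * q) * Σ[ (λ w → bᵢ w * p w) ]
         + d * (q * q) * ((μᵢ + [ B i u ] 1#) * p u)

    on-side : ∀ {O Q} (sides : Sides i O Q) (uO : u ∈ O) →
              (∀ w → bᵢ w ≈ [ (O ─ u) w ] (c i * ℕ→R (countℕ Q ∸ 1))) →
              μᵢ + [ B i u ] 1# ≈ c i * ℕ→R (countℕ Q ∸ 1) + 1# →
              Tᵢ ≈ BlockContribution.contribution sides uO v (c i)
                     (BlockContribution.ΣQ sides uO v (c i)) (BlockContribution.ΣO sides uO v (c i)) (p u)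
    on-side {O} {Q} sides uO b≈ μ≈ =
      +-cong (+-cong (*-congˡ (Σ-indicator Q aᵢ p (c i) (λ w → [-]-≡ (c i) (Sides.adj-in-block sides uO w))))
                     (*-congˡ (Σ-indicator (O ─ u) bᵢ p _ b≈)))
             (*-congˡ (*-congʳ μ≈))

    module _ (hc : InvertsBlockFactors) where

      hyp-for : ∀ k l → k Nat.* l ≡ (m i ∸ 1) Nat.* (n i ∸ 1) → c i * (1# - (q * q) * (ℕ→R k * ℕ→R l)) ≈ 1#
      hyp-for k l kl≡ = trans (*-congˡ (+-congˡ (-‿cong (*-congˡ (trans (sym (ℕ→R-* k l)) (reflexive (≡.cong ℕ→R kl≡)))))))
                              (hc i)

      towards-on-block : u ∈ B i → not (does (gate i v ≟ u)) ≡ towards u v i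
      towards-on-block uB = ≡.sym (≡.cong (_∧ not (does (gate i v ≟ u))) uB)

      block : Tᵢ ≈ [ towards u v i ] (d * (q * q - 1#) * p u)
      block with true-or-false (X i u) | true-or-false (Y i u)
      ... | inj₁ uX | inj₁ uY = ⊥-elim (disjoint i u uX uY)
      ... | inj₁ uX | inj₂ u∉Y =
        trans (on-side sidesXY′ uX b≈ μ≈)
              (trans (BlockContribution.contribution≈ sidesXY′ uX v (c i) hyp) ([-]-≡ _ (towards-on-block (Sides.O⊆B sidesXY′ u uX))))
        where
        sidesXY′ = sidesXY i
        hyp = hyp-for (countℕ (X i ─ u)) (n i ∸ 1) (≡.cong (Nat._* (n i ∸ 1)) (≡.cong (_∸ 1) (≡.sym (count-remove (X i) u uX))))
        b≈ : ∀ w → bᵢ w ≈ [ (X i ─ u) w ] (c i * ℕ→R (n i ∸ 1))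
        b≈ w = trans (+-cong ([-]-≡ _ (Sides.nonadjacent-same-side sidesXY′ uX w))
                             ([-]-≡ _ (Sides.nonadjacent-other-side sidesXY′ uX w)))
                     (+-identityʳ _)
        μ≈ : μᵢ + [ B i u ] 1# ≈ c i * ℕ→R (n i ∸ 1) + 1#
        μ≈ rewrite uX | u∉Y = +-congʳ (+-identityʳ _)
      ... | inj₂ u∉X | inj₁ uY =
        trans (on-side sidesYX′ uY b≈ μ≈)
              (trans (BlockContribution.contribution≈ sidesYX′ uY v (c i) hyp) ([-]-≡ _ (towards-on-block (Sides.O⊆B sidesYX′ u uY))))
        where
        sidesYX′ = sidesYX i
        hyp = hyp-for (countℕ (Y i ─ u)) (m i ∸ 1)
                (≡.trans (≡.cong (Nat._* (m i ∸ 1)) (≡.cong (_∸ 1) (≡.sym (count-remove (Y i) u uY))))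
                         (ℕₚ.*-comm (n i ∸ 1) (m i ∸ 1)))
        b≈ : ∀ w → bᵢ w ≈ [ (Y i ─ u) w ] (c i * ℕ→R (m i ∸ 1))
        b≈ w = trans (+-cong ([-]-≡ _ (Sides.nonadjacent-other-side sidesYX′ uY w))
                             ([-]-≡ _ (Sides.nonadjacent-same-side sidesYX′ uY w)))
                     (+-identityˡ _)
        μ≈ : μᵢ + [ B i u ] 1# ≈ c i * ℕ→R (m i ∸ 1) + 1#
        μ≈ rewrite u∉X | uY = +-congʳ (+-identityˡ _)
      ... | inj₂ u∉X | inj₂ u∉Y = begin
        Tᵢ
          ≈⟨ +-cong (+-cong (*-congˡ (Σ-zero _ (λ w → trans (*-congʳ (a≈0 w)) (zeroˡ _))))
                            (*-congˡ (Σ-zero _ (λ w → trans (*-congʳ (b≈0 w)) (zeroˡ _)))))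
                    (*-congˡ (trans (*-congʳ μ≈0) (zeroˡ _))) ⟩
        - (d * q) * 0# + d * (q * q) * 0# + d * (q * q) * 0#
          ≈⟨ solve 2 (λ d q → (:- (d :* q)) :* con (+ 0) :+ d :* (q :* q) :* con (+ 0) :+ d :* (q :* q) :* con (+ 0)
                              := con (+ 0)) refl d q ⟩
        0#
          ≈⟨ [-]-≡ _ towards-on-blockfalse ⟨
        [ towards u v i ] (d * (q * q - 1#) * p u) ∎
        where
        u∉B : B i u ≡ false
        u∉B rewrite u∉X = u∉Y
        towards-on-blockfalse : towards u v i ≡ false
        towards-on-blockfalse = ≡.cong (_∧ not (does (gate i v ≟ u))) u∉B
        a≈0 : ∀ w → aᵢ w ≈ 0#
        a≈0 w = [-]-≡ (c i) (≡.trans (≡.cong (λ b → adj u w ∧ b ∧ B i w) u∉B) (∧-zeroʳ (adj u w)))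
        b≈0 : ∀ w → bᵢ w ≈ 0#
        b≈0 w rewrite u∉X | u∉Y | ∧-zeroʳ (not (adj u w)) | ∧-zeroʳ (not (δ u w)) = +-identityʳ 0#
        μ≈0 : μᵢ + [ B i u ] 1# ≈ 0#
        μ≈0 rewrite u∉X | u∉Y = trans (+-identityʳ _) (+-identityʳ 0#)

  module _ (hd : d * (1# - q * q) ≈ 1#) (hc : InvertsBlockFactors) where

    module _ (u v : Fin N) where
      open BlockRow u v using (aᵢ; bᵢ; μᵢ; Tᵢ; block)

      p : Fin N → Carrier
      p w = expDist w v

      Σμ : Σ[ (λ w → [ δ u w ] (μ w) * p w) ] ≈ (Σ[ μᵢ ] + (Σ[ (λ i → [ B i u ] 1#) ] - 1#)) * p u
      Σμ = trans (Σ-cong (λ w → [-]-*ʳ (δ u w) (μ w) (p w)))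
                 (trans (Σ-δ u (λ w → μ w * p w)) (*-congʳ (+-congˡ (+-congʳ (ℕ→R-count (λ i → B i u))))))

      ΣT : Σ[ Tᵢ ] ≈ - (d * q) * Σ[ (λ i → Σ[ (λ w → aᵢ i w * p w) ]) ] + d * (q * q) * Σ[ (λ i → Σ[ (λ w → bᵢ i w * p w) ]) ]
                     + d * (q * q) * ((Σ[ μᵢ ] + Σ[ (λ i → [ B i u ] 1#) ]) * p u)
      ΣT = trans (Σ-linear₃ {r} _ _ _ (λ i → Σ[ (λ w → aᵢ i w * p w) ]) (λ i → Σ[ (λ w → bᵢ i w * p w) ])
                                  (λ i → (μᵢ i + [ B i u ] 1#) * p u))
                 (+-congˡ (*-congˡ (trans (sym (*-distribʳ-Σ (λ i → μᵢ i + [ B i u ] 1#) (p u)))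
                                          (*-congʳ (Σ-distrib-+ μᵢ (λ i → [ B i u ] 1#))))))

      row : (RHS · expDist) u v ≈ d * p u - d * (q * q) * p u + Σ[ Tᵢ ]
      row = begin
        Σ[ (λ w → RHS u w * p w) ]
          ≈⟨ Σ-cong (λ w → solve 7 (λ d q Iw Aw Bw Mw pw →
               (d :* Iw :- d :* q :* Aw :+ d :* (q :* q) :* Bw :+ d :* (q :* q) :* Mw) :* pw
               := d :* (Iw :* pw) :+ ((:- (d :* q)) :* (Aw :* pw) :+ d :* (q :* q) :* (Bw :* pw) :+ d :* (q :* q) :* (Mw :* pw)))
               refl d q (I u w) (𝐀 u w) (𝐁 u w) ([ δ u w ] (μ w)) (p w)) ⟩
        Σ[ (λ w → d * (I u w * p w) + (- (d * q) * (𝐀 u w * p w) + d * (q * q) * (𝐁 u w * p w)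
                                       + d * (q * q) * ([ δ u w ] (μ w) * p w))) ]
          ≈⟨ trans (Σ-distrib-+ {N} _ _) (+-cong (sym (*-distribˡ-Σ d (λ w → I u w * p w)))
                                                  (Σ-linear₃ _ _ _ (λ w → 𝐀 u w * p w) (λ w → 𝐁 u w * p w)
                                                                   (λ w → [ δ u w ] (μ w) * p w))) ⟩
        d * (I · expDist) u v + (- (d * q) * Σ[ (λ w → 𝐀 u w * p w) ] + d * (q * q) * Σ[ (λ w → 𝐁 u w * p w) ]
                                 + d * (q * q) * Σ[ (λ w → [ δ u w ] (μ w) * p w) ])
          ≈⟨ +-cong (*-congˡ (·-identityˡ expDist u v)) (+-cong (+-cong (*-congˡ (Σ-Σ-*ʳ aᵢ p)) (*-congˡ (Σ-Σ-*ʳ bᵢ p))) (*-congˡ Σμ)) ⟩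
        d * p u + (- (d * q) * ΣA + d * (q * q) * ΣB + d * (q * q) * ((Σμᵢ + (ΣBu - 1#)) * p u))
          ≈⟨ solve 7 (λ d q pu A B M K →
               d :* pu :+ ((:- (d :* q)) :* A :+ d :* (q :* q) :* B :+ d :* (q :* q) :* ((M :+ (K :- con (+ 1))) :* pu))
               := d :* pu :- d :* (q :* q) :* pu :+ ((:- (d :* q)) :* A :+ d :* (q :* q) :* B :+ d :* (q :* q) :* ((M :+ K) :* pu)))
               refl d q (p u) ΣA ΣB Σμᵢ ΣBu ⟩
        d * p u - d * (q * q) * p u + (- (d * q) * ΣA + d * (q * q) * ΣB + d * (q * q) * ((Σμᵢ + ΣBu) * p u))
          ≈⟨ +-congˡ ΣT ⟨
        d * p u - d * (q * q) * p u + Σ[ Tᵢ ] ∎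
        where
        ΣA = Σ[ (λ i → Σ[ (λ w → aᵢ i w * p w) ]) ]
        ΣB = Σ[ (λ i → Σ[ (λ w → bᵢ i w * p w) ]) ]
        Σμᵢ = Σ[ μᵢ ]
        ΣBu = Σ[ (λ i → [ B i u ] 1#) ]

      ΣT≈ : Σ[ Tᵢ ] ≈ ℕ→R (countℕ (towards u v)) * (d * (q * q - 1#) * p u)
      ΣT≈ = trans (Σ-cong (λ i → block i hc)) (Σ-over-const (towards u v) _ _ (λ _ _ → refl))

      RHS·expDist≈I : (RHS · expDist) u v ≈ I u v
      RHS·expDist≈I with u ≟ v
      ... | yes ≡.refl = begin
        (RHS · expDist) u u
          ≈⟨ trans row (+-congˡ ΣT≈) ⟩
        d * pow q (dist u u) - d * (q * q) * pow q (dist u u) + ℕ→R (countℕ (towards u u)) * (d * (q * q - 1#) * p u)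
          ≡⟨ ≡.cong₂ (λ k l → d * pow q k - d * (q * q) * pow q k + ℕ→R l * (d * (q * q - 1#) * p u))
                     (dist-refl u) (count-towards-self u) ⟩
        d * 1# - d * (q * q) * 1# + 0# * (d * (q * q - 1#) * p u)
          ≈⟨ solve 3 (λ d q X → d :* con (+ 1) :- d :* (q :* q) :* con (+ 1) :+ con (+ 0) :* X
                                := d :* (con (+ 1) :- q :* q)) refl d q (d * (q * q - 1#) * p u) ⟩
        d * (1# - q * q)
          ≈⟨ hd ⟩
        1# ∎
      ... | no u≢v = begin
        (RHS · expDist) u v
          ≈⟨ trans row (+-congˡ ΣT≈) ⟩
        d * p u - d * (q * q) * p u + ℕ→R (countℕ (towards u v)) * (d * (q * q - 1#) * p u)
          ≡⟨ ≡.cong (λ l → d * p u - d * (q * q) * p u + ℕ→R l * (d * (q * q - 1#) * p u)) (count-towards-≢ u≢v) ⟩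
        d * p u - d * (q * q) * p u + (1# + 0#) * (d * (q * q - 1#) * p u)
          ≈⟨ solve 3 (λ d q pu → d :* pu :- d :* (q :* q) :* pu :+ (con (+ 1) :+ con (+ 0)) :* (d :* (q :* q :- con (+ 1)) :* pu)
                                 := con (+ 0)) refl d q (p u) ⟩
        0# ∎

open Nat using (_*_)

mainTheorem2 : ∀ {a ℓ : Level} (K : Field a ℓ) {N r : ℕ}
    (G : Graph N) (D : BiBlock G r) (q : Field.Carrier K) →
    ¬ (Field._≈_ K q (Field.0# K)) →
    (d : Field.Carrier K) →
    Field._≈_ K (Field._*_ K d (Field._-_ K (Field.1# K) (Field._*_ K q q))) (Field.1# K) →
    (c : Fin r → Field.Carrier K) →
    (∀ i → Field._≈_ K
      (Field._*_ K (c i)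
        (Field._-_ K (Field.1# K)
          (Field._*_ K (Field._*_ K q q)
            (Matrices.ℕ→R (Field.commutativeRing K)
              ((Matrices.Formula.m (Field.commutativeRing K) G D q d c i ∸ 1)
                * (Matrices.Formula.n (Field.commutativeRing K) G D q d c i ∸ 1))))))
      (Field.1# K)) →
    (F : Matrices.Matrix (Field.commutativeRing K) N) →
    Matrices.IsExpDist (Field.commutativeRing K) G q F →
    (M : Matrices.Matrix (Field.commutativeRing K) N) →
    Matrices._≈M_ (Field.commutativeRing K) (Matrices._·_ (Field.commutativeRing K) M F) (Matrices.I (Field.commutativeRing K)) →
    Matrices._≈M_ (Field.commutativeRing K) (Matrices._·_ (Field.commutativeRing K) F M) (Matrices.I (Field.commutativeRing K)) →
    Matrices._≈M_ (Field.commutativeRing K) M (Matrices.Formula.RHS (Field.commutativeRing K) G D q d c)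
mainTheorem2 K G D q _ d hd c hc F isExpDist M _ FM≈I =
  right-inverse≈left-inverse RHS F M RHS·F≈I FM≈I
  where
  R = Field.commutativeRing K
  open CommutativeRing R using (trans)
  open Matrices R using (_·_)
  open Matrices.Formula R G D q d c using (RHS)
  open BiBlockDistances G D using (dist; dist-isDist)
  open Sums R using (right-inverse≈left-inverse; ·-congʳ)
  open CandidateInverse R G D q d c using (expDist; RHS·expDist≈I)
  RHS·F≈I : Matrices._≈M_ R (RHS · F) (Matrices.I R)
  RHS·F≈I u v = trans (·-congʳ RHS (λ w v → isExpDist w v (dist w v) (dist-isDist w v)) u v) (RHS·expDist≈I hd hc u v)
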